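{- For every non-negative integer $m$, \[ T_m(q)=\sum_{1\le c_1<\dots<c_m\le 2m}\ \prod_{j=1}^m[r_j-(j-1)]_q, \] where $r_j=\#\{i\in\{1,\dots,m\}: c_i\le j+i-1\}$.
   Context: For a fixed-point-free involution $\sigma$ of $\{1,\dots,2m\}$, its arcs are the pairs $(i,\sigma(i))$ with $i<\sigma(i)$; a crossing is a pair of arcs $(i,j),(k,l)$ with $i<k<j<l$, and $v(\sigma)$ is the number of crossings. $T_m(q)=\sum_\sigma q^{v(\sigma)}$, summed over all fixed-point-free involutions $\sigma$ of $\{1,\dots,2m\}$. For a non-negative integer $n$, $[n]_q=1+q+\dots+q^{n-1}$. -}

module Defs where

open import Data.Nat using (ℕ; zero; suc; _+_; _*_; _∸_; _≤_; _<_; _≤?_; _<?_)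
open import Data.Nat.Properties using (_≟_)
open import Data.Fin using (Fin; toℕ)
open import Data.Fin.Properties using (all?) renaming (_≟_ to _≟ᶠ_)
open import Data.Vec using (Vec; []; _∷_; lookup)
open import Data.List using (List; []; _∷_; map; concatMap; allFin; filter; length; foldr; replicate)
open import Data.Bool using (if_then_else_)
open import Data.Product using (_×_)
open import Data.Nat.ListAction using (sum)
open import Relation.Nullary using (¬_; Dec; ¬?; _×-dec_)
open import Relation.Nullary.Decidable using (⌊_⌋)
open import Relation.Binary.PropositionalEquality using (_≡_)

-- Polynomials in q with natural-number coefficients, as coefficient
-- lists (constant term first).  Equality is coefficientwise.

Poly : Set
Poly = List ℕ

_⊕_ : Poly → Poly → Poly
[] ⊕ ys = ys
(x ∷ xs) ⊕ [] = x ∷ xs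
(x ∷ xs) ⊕ (y ∷ ys) = (x + y) ∷ (xs ⊕ ys)

scale : ℕ → Poly → Poly
scale c = map (c *_)

_⊗_ : Poly → Poly → Poly
[] ⊗ ys = []
(x ∷ xs) ⊗ ys = scale x ys ⊕ (0 ∷ (xs ⊗ ys))

zeroP : Poly
zeroP = []

oneP : Poly
oneP = 1 ∷ []

qpow : ℕ → Poly
qpow zero = 1 ∷ []
qpow (suc k) = 0 ∷ qpow k

qint : ℕ → Poly
qint n = replicate n 1

coeff : Poly → ℕ → ℕ
coeff [] k = 0
coeff (x ∷ xs) zero = x
coeff (x ∷ xs) (suc k) = coeff xs k

_≈P_ : Poly → Poly → Set
p ≈P r = ∀ k → coeff p k ≡ coeff r k

sumP : {A : Set} → (A → Poly) → List A → Poly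
sumP f xs = foldr (λ x acc → f x ⊕ acc) zeroP xs

prodP : {A : Set} → (A → Poly) → List A → Poly
prodP f xs = foldr (λ x acc → f x ⊗ acc) oneP xs

allVecs : (k n : ℕ) → List (Vec (Fin n) k)
allVecs zero n = [] ∷ []
allVecs (suc k) n = concatMap (λ a → map (a ∷_) (allVecs k n)) (allFin n)

countFin : (n : ℕ) → {P : Fin n → Set} → ((i : Fin n) → Dec (P i)) → ℕ
countFin n P? = length (filter P? (allFin n))

-- Fixed-point-free involutions of {1,…,n} (encoded as Fin n, with the
-- element i : Fin n standing for toℕ i + 1), given as the vector of
-- values σ(0),…,σ(n-1).

IsFPFInvolution : {n : ℕ} → Vec (Fin n) n → Set
IsFPFInvolution {n} σ =
  (∀ i → lookup σ (lookup σ i) ≡ i) × (∀ i → ¬ (lookup σ i ≡ i))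

isFPFInvolution? : {n : ℕ} → (σ : Vec (Fin n) n) → Dec (IsFPFInvolution σ)
isFPFInvolution? σ =
  all? (λ i → lookup σ (lookup σ i) ≟ᶠ i) ×-dec all? (λ i → ¬? (lookup σ i ≟ᶠ i))

Crossing : {n : ℕ} → Vec (Fin n) n → Fin n → Fin n → Fin n → Fin n → Set
Crossing σ i j k l =
  (toℕ i < toℕ k) × (toℕ k < toℕ j) × (toℕ j < toℕ l)
  × (lookup σ i ≡ j) × (lookup σ k ≡ l)

crossing? : {n : ℕ} → (σ : Vec (Fin n) n) → (i j k l : Fin n) → Dec (Crossing σ i j k l)
crossing? σ i j k l =
  (toℕ i <? toℕ k) ×-dec (toℕ k <? toℕ j) ×-dec (toℕ j <? toℕ l)
  ×-dec (lookup σ i ≟ᶠ j) ×-dec (lookup σ k ≟ᶠ l)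

indicator : {P : Set} → Dec P → ℕ
indicator d = if ⌊ d ⌋ then 1 else 0

crossings : {n : ℕ} → Vec (Fin n) n → ℕ
crossings {n} σ =
  sum (map (λ i → sum (map (λ j → sum (map (λ k → sum (map (λ l →
    indicator (crossing? σ i j k l)) (allFin n))) (allFin n))) (allFin n))) (allFin n))

T : ℕ → Poly
T m = sumP (λ σ → qpow (crossings σ)) (filter isFPFInvolution? (allVecs (2 * m) (2 * m)))

-- Right-hand side.  A sequence c : Fin m → Fin (2m), where c_i (1-based
-- i = toℕ i' + 1) has value toℕ (c i') + 1 ∈ {1,…,2m}.

StrictlyIncreasing : {m n : ℕ} → Vec (Fin n) m → Set
StrictlyIncreasing {m} c =
  ∀ (a b : Fin m) → toℕ a < toℕ b → toℕ (lookup c a) < toℕ (lookup c b)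

strictlyIncreasing? : {m n : ℕ} → (c : Vec (Fin n) m) → Dec (StrictlyIncreasing c)
strictlyIncreasing? c =
  all? (λ a → all? (λ b → Relation.Nullary.Decidable._→-dec_
    (toℕ a <? toℕ b) (toℕ (lookup c a) <? toℕ (lookup c b))))
  where import Relation.Nullary.Decidable

-- r_j = #{ i ∈ {1,…,m} : c_i ≤ j + i - 1 }   (j ≥ 1, i 1-based)
r : {m n : ℕ} → Vec (Fin n) m → ℕ → ℕ
r {m} c j = countFin m (λ i' → (toℕ (lookup c i') + 1) ≤? (j + (toℕ i' + 1) ∸ 1))

-- ∏_{j=1}^m [r_j - (j-1)]_q   (truncated subtraction)
term : {m n : ℕ} → Vec (Fin n) m → Poly
term {m} c = prodP (λ j' → qint (r c (toℕ j' + 1) ∸ toℕ j')) (allFin m)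

RHS : ℕ → Poly
RHS m = sumP term (filter strictlyIncreasing? (allVecs m (2 * m)))

-- Both sides are the same weighted count of lattice walks.  Let walks k s be the
-- generating polynomial of walks of k steps from height s down to height 0,
-- where an up step s → s+1 has weight 1 and a down step s → s−1 has weight [s]_q.
--
-- Left side: scan an involution from left to right, keeping the stack of arcs
-- that are still open.  Position p either opens a new arc (up step, its partner
-- being determined later) or closes one of the s open arcs (down step).  Closing
-- the arc opened at a crosses exactly the open arcs opened after a, so summing
-- over the s choices gives [s]_q, and the crossing number of σ is the total weight.
--
-- Right side: scan the positions 0,…,2m−1, where after t entries of c and
-- J factors of the product the height is t − J.  A position either is the next
-- entry c_{t+1} (up step) or yields the next factor [r_{J+1} − J]_q, and at that
-- moment r_{J+1} = t (down step).

module Submission where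

open import Defs
open import Data.Bool using (Bool; true; false; if_then_else_; _∧_; _∨_; not) renaming (T to IsTrue)
open import Data.Bool.ListAction using (all)
open import Data.Bool.Properties using (T-≡; ¬-not; ∧-zeroʳ; ∧-identityʳ)
open import Data.Empty using (⊥-elim)
open import Data.Fin using (Fin; toℕ; fromℕ<) renaming (zero to fz; suc to fs)
open import Data.Fin.Properties using (toℕ-injective; toℕ<n; toℕ-fromℕ<) renaming (_≟_ to _≟ᶠ_)
open import Data.List using (List; []; _∷_; map; concatMap; _++_; length; tabulate; allFin; filter; filterᵇ; null; downFrom; drop)
open import Data.List.Properties using (length-drop; map-tabulate)
open import Data.List.Relation.Unary.All as All using (All; []; _∷_)
open import Data.Nat using (ℕ; zero; suc; _+_; _*_; _∸_; _≤_; _<_; z≤n; s≤s; _≤ᵇ_; _<ᵇ_; _≡ᵇ_)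
open import Data.Nat.ListAction using (sum)
open import Data.Nat.Properties
open import Data.Nat.Tactic.RingSolver using (solve-∀)
open import Algebra.Properties.CommutativeSemigroup +-commutativeSemigroup using (interchange)
open import Data.Product using (_×_; _,_; proj₁; proj₂)
open import Data.Sum using (inj₁; inj₂)
open import Data.Unit using (⊤; tt)
open import Data.Vec using (Vec; []; _∷_; lookup)
open import Function using (_∘_; Equivalence)
open import Relation.Binary using (Setoid; Tri; tri<; tri≈; tri>)
open import Relation.Binary.PropositionalEquality
open import Relation.Nullary using (Dec; does; yes; no)
open import Relation.Nullary.Decidable using (dec-true; dec-false)
open import Relation.Unary using (Pred; Decidable)
import Relation.Binary.Reasoning.Setoid as SetoidReasoning

≤ᵇ-true : ∀ {a b} → a ≤ b → (a ≤ᵇ b) ≡ true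
≤ᵇ-true p = Equivalence.to T-≡ (≤⇒≤ᵇ p)

≤ᵇ-true⁻¹ : ∀ {a b} → (a ≤ᵇ b) ≡ true → a ≤ b
≤ᵇ-true⁻¹ {a} {b} e = ≤ᵇ⇒≤ a b (Equivalence.from T-≡ e)

≤ᵇ-false : ∀ {a b} → b < a → (a ≤ᵇ b) ≡ false
≤ᵇ-false p = ¬-not (λ e → <⇒≱ p (≤ᵇ-true⁻¹ e))

≤ᵇ-false⁻¹ : ∀ {a b} → (a ≤ᵇ b) ≡ false → b < a
≤ᵇ-false⁻¹ e = ≰⇒> (λ p → subst IsTrue e (≤⇒≤ᵇ p))

<ᵇ-true : ∀ {a b} → a < b → (a <ᵇ b) ≡ true
<ᵇ-true = ≤ᵇ-true

<ᵇ-true⁻¹ : ∀ {a b} → (a <ᵇ b) ≡ true → a < b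
<ᵇ-true⁻¹ = ≤ᵇ-true⁻¹

<ᵇ-false : ∀ {a b} → b ≤ a → (a <ᵇ b) ≡ false
<ᵇ-false p = ≤ᵇ-false (s≤s p)

<ᵇ-false⁻¹ : ∀ {a b} → (a <ᵇ b) ≡ false → b ≤ a
<ᵇ-false⁻¹ {a} e = ≤-pred (≤ᵇ-false⁻¹ {suc a} e)

<ᵇ-suc : ∀ a b → (a <ᵇ suc b) ≡ (a ≤ᵇ b)
<ᵇ-suc zero b = refl
<ᵇ-suc (suc a) b = refl

≡ᵇ-refl : ∀ a → (a ≡ᵇ a) ≡ true
≡ᵇ-refl a = Equivalence.to T-≡ (≡⇒≡ᵇ a a refl)

≡ᵇ-true⁻¹ : ∀ {a b} → (a ≡ᵇ b) ≡ true → a ≡ b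
≡ᵇ-true⁻¹ {a} {b} e = ≡ᵇ⇒≡ a b (Equivalence.from T-≡ e)

≡ᵇ-false : ∀ {a b} → a ≢ b → (a ≡ᵇ b) ≡ false
≡ᵇ-false ne = ¬-not (λ e → ne (≡ᵇ-true⁻¹ e))

≡ᵇ-false⁻¹ : ∀ {a b} → (a ≡ᵇ b) ≡ false → a ≢ b
≡ᵇ-false⁻¹ {a} e refl = subst IsTrue e (≡⇒≡ᵇ a a refl)

<ᵇ-suc-∧ : ∀ y p b → ((y <ᵇ suc p) ∧ ((y <ᵇ p) ∧ b)) ≡ ((y <ᵇ p) ∧ b)
<ᵇ-suc-∧ y p b with y <ᵇ p in e
... | true rewrite <ᵇ-true {y} {suc p} (<-trans (<ᵇ-true⁻¹ e) (n<1+n p)) = refl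
... | false = ∧-zeroʳ (y <ᵇ suc p)

≡ᵇ-<ᵇ-suc : ∀ y p → (y ≡ᵇ p) ≡ ((y <ᵇ suc p) ∧ (y ≡ᵇ p))
≡ᵇ-<ᵇ-suc y p with y ≡ᵇ p in e
... | true rewrite <ᵇ-true {y} {suc p} (s≤s (≤-reflexive (≡ᵇ-true⁻¹ e))) = refl
... | false = sym (∧-zeroʳ (y <ᵇ suc p))

∧-true⁻¹ : ∀ {a b} → (a ∧ b) ≡ true → a ≡ true × b ≡ true
∧-true⁻¹ {true} {true} e = refl , refl

true≢false : true ≢ false
true≢false ()

ι : Bool → ℕ
ι b = if b then 1 else 0

ι-∧ : ∀ a b → ι (a ∧ b) ≡ ι a * ι b
ι-∧ true b = sym (+-identityʳ (ι b))
ι-∧ false b = refl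

countᵇ : {A : Set} → (A → Bool) → List A → ℕ
countᵇ g [] = 0
countᵇ g (x ∷ xs) = ι (g x) + countᵇ g xs

-- A record around _≈P_, so that the two polynomials can be inferred from a proof.
infix 4 _≈_
record _≈_ (p q : Poly) : Set where
  constructor mk
  field ap : p ≈P q
open _≈_ public

≈-refl : ∀ {p} → p ≈ p
≈-refl = mk λ k → refl

≈-sym : ∀ {p q} → p ≈ q → q ≈ p
≈-sym e = mk λ k → sym (ap e k)

≈-trans : ∀ {p q r} → p ≈ q → q ≈ r → p ≈ r
≈-trans e f = mk λ k → trans (ap e k) (ap f k)

≈-setoid : Setoid _ _
≈-setoid = record
  { Carrier = Poly ; _≈_ = _≈_
  ; isEquivalence = record { refl = ≈-refl ; sym = ≈-sym ; trans = ≈-trans } }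

module ≈-Reasoning = SetoidReasoning ≈-setoid

≡⇒≈ : ∀ {p q} → p ≡ q → p ≈ q
≡⇒≈ refl = ≈-refl

coeff-⊕ : ∀ p q k → coeff (p ⊕ q) k ≡ coeff p k + coeff q k
coeff-⊕ [] q k = refl
coeff-⊕ (x ∷ p) [] k = sym (+-identityʳ _)
coeff-⊕ (x ∷ p) (y ∷ q) zero = refl
coeff-⊕ (x ∷ p) (y ∷ q) (suc k) = coeff-⊕ p q k

coeff-scale : ∀ c p k → coeff (scale c p) k ≡ c * coeff p k
coeff-scale c [] k = sym (*-zeroʳ c)
coeff-scale c (x ∷ p) zero = refl
coeff-scale c (x ∷ p) (suc k) = coeff-scale c p k

⊕-cong : ∀ {p p' q q'} → p ≈ p' → q ≈ q' → (p ⊕ q) ≈ (p' ⊕ q')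
⊕-cong {p} {p'} {q} {q'} e f = mk λ k → begin
  coeff (p ⊕ q) k          ≡⟨ coeff-⊕ p q k ⟩
  coeff p k + coeff q k    ≡⟨ cong₂ _+_ (ap e k) (ap f k) ⟩
  coeff p' k + coeff q' k  ≡⟨ coeff-⊕ p' q' k ⟨
  coeff (p' ⊕ q') k        ∎
  where open ≡-Reasoning

⊕-congʳ : ∀ p {q q'} → q ≈ q' → (p ⊕ q) ≈ (p ⊕ q')
⊕-congʳ p = ⊕-cong (≈-refl {p})

⊕-comm : ∀ p q → (p ⊕ q) ≈ (q ⊕ p)
⊕-comm p q = mk λ k → trans (coeff-⊕ p q k) (trans (+-comm (coeff p k) _) (sym (coeff-⊕ q p k)))

⊕-assoc : ∀ p q r → ((p ⊕ q) ⊕ r) ≈ (p ⊕ (q ⊕ r))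
⊕-assoc p q r = mk λ k → begin
  coeff ((p ⊕ q) ⊕ r) k                 ≡⟨ trans (coeff-⊕ (p ⊕ q) r k) (cong (_+ coeff r k) (coeff-⊕ p q k)) ⟩
  coeff p k + coeff q k + coeff r k     ≡⟨ +-assoc (coeff p k) _ _ ⟩
  coeff p k + (coeff q k + coeff r k)   ≡⟨ trans (coeff-⊕ p (q ⊕ r) k) (cong (coeff p k +_) (coeff-⊕ q r k)) ⟨
  coeff (p ⊕ (q ⊕ r)) k                 ∎
  where open ≡-Reasoning

⊕-identityʳ : ∀ p → (p ⊕ []) ≈ p
⊕-identityʳ p = mk λ k → trans (coeff-⊕ p [] k) (+-identityʳ _)

⊕-interchange : ∀ a b c d → ((a ⊕ b) ⊕ (c ⊕ d)) ≈ ((a ⊕ c) ⊕ (b ⊕ d))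
⊕-interchange a b c d = mk λ k → begin
  coeff ((a ⊕ b) ⊕ (c ⊕ d)) k
    ≡⟨ trans (coeff-⊕ (a ⊕ b) _ k) (cong₂ _+_ (coeff-⊕ a b k) (coeff-⊕ c d k)) ⟩
  (coeff a k + coeff b k) + (coeff c k + coeff d k)
    ≡⟨ interchange (coeff a k) (coeff b k) (coeff c k) (coeff d k) ⟩
  (coeff a k + coeff c k) + (coeff b k + coeff d k)
    ≡⟨ trans (coeff-⊕ (a ⊕ c) _ k) (cong₂ _+_ (coeff-⊕ a c k) (coeff-⊕ b d k)) ⟨
  coeff ((a ⊕ c) ⊕ (b ⊕ d)) k ∎
  where open ≡-Reasoning

scale-cong : ∀ c {p q} → p ≈ q → scale c p ≈ scale c q
scale-cong c {p} {q} e = mk λ k → trans (coeff-scale c p k) (trans (cong (c *_) (ap e k)) (sym (coeff-scale c q k)))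

scale-identity : ∀ p → scale 1 p ≈ p
scale-identity p = mk λ k → trans (coeff-scale 1 p k) (+-identityʳ _)

scale-zero : ∀ p → scale 0 p ≈ []
scale-zero p = mk λ k → coeff-scale 0 p k

scale-distrib-⊕ : ∀ x a b → scale x (a ⊕ b) ≈ (scale x a ⊕ scale x b)
scale-distrib-⊕ x a b = mk λ k → begin
  coeff (scale x (a ⊕ b)) k                ≡⟨ trans (coeff-scale x (a ⊕ b) k) (cong (x *_) (coeff-⊕ a b k)) ⟩
  x * (coeff a k + coeff b k)              ≡⟨ *-distribˡ-+ x (coeff a k) _ ⟩
  x * coeff a k + x * coeff b k            ≡⟨ trans (coeff-⊕ (scale x a) _ k) (cong₂ _+_ (coeff-scale x a k) (coeff-scale x b k)) ⟨
  coeff (scale x a ⊕ scale x b) k          ∎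
  where open ≡-Reasoning

scale-distrib-+ : ∀ x y q → scale (x + y) q ≈ (scale x q ⊕ scale y q)
scale-distrib-+ x y q = mk λ k → begin
  coeff (scale (x + y) q) k                ≡⟨ coeff-scale (x + y) q k ⟩
  (x + y) * coeff q k                      ≡⟨ *-distribʳ-+ (coeff q k) x y ⟩
  x * coeff q k + y * coeff q k            ≡⟨ trans (coeff-⊕ (scale x q) _ k) (cong₂ _+_ (coeff-scale x q k) (coeff-scale y q k)) ⟨
  coeff (scale x q ⊕ scale y q) k          ∎
  where open ≡-Reasoning

∷-cong : ∀ {x p q} → p ≈ q → (x ∷ p) ≈ (x ∷ q)
∷-cong e = mk λ { zero → refl ; (suc k) → ap e k }

0∷-zero : ∀ {p} → p ≈ [] → (0 ∷ p) ≈ []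
0∷-zero e = mk λ { zero → refl ; (suc k) → ap e k }

0∷-distrib-⊕ : ∀ u v → (0 ∷ (u ⊕ v)) ≈ ((0 ∷ u) ⊕ (0 ∷ v))
0∷-distrib-⊕ u v = mk λ { zero → refl ; (suc k) → refl }

⊗-zeroʳ : ∀ p → (p ⊗ []) ≈ []
⊗-zeroʳ [] = ≈-refl
⊗-zeroʳ (x ∷ p) = 0∷-zero (⊗-zeroʳ p)

⊗-zeroˡ : ∀ {p} q → p ≈ [] → (p ⊗ q) ≈ []
⊗-zeroˡ {[]} q e = ≈-refl
⊗-zeroˡ {x ∷ p} q e =
  ⊕-cong (≈-trans (≡⇒≈ (cong (λ c → scale c q) (ap e zero))) (scale-zero q))
         (0∷-zero (⊗-zeroˡ {p} q (mk λ k → ap e (suc k))))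

⊗-congʳ : ∀ p {q q'} → q ≈ q' → (p ⊗ q) ≈ (p ⊗ q')
⊗-congʳ [] e = ≈-refl
⊗-congʳ (x ∷ p) e = ⊕-cong (scale-cong x e) (∷-cong (⊗-congʳ p e))

⊗-congˡ : ∀ {p p'} q → p ≈ p' → (p ⊗ q) ≈ (p' ⊗ q)
⊗-congˡ {[]} q e = ≈-sym (⊗-zeroˡ q (≈-sym e))
⊗-congˡ {x ∷ p} {[]} q e = ⊗-zeroˡ q e
⊗-congˡ {x ∷ p} {y ∷ p'} q e =
  ⊕-cong (≡⇒≈ (cong (λ c → scale c q) (ap e zero))) (∷-cong (⊗-congˡ {p} {p'} q (mk λ k → ap e (suc k))))

⊗-distribˡ-⊕ : ∀ p a b → (p ⊗ (a ⊕ b)) ≈ ((p ⊗ a) ⊕ (p ⊗ b))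
⊗-distribˡ-⊕ [] a b = ≈-refl
⊗-distribˡ-⊕ (x ∷ p) a b = begin
  scale x (a ⊕ b) ⊕ (0 ∷ (p ⊗ (a ⊕ b)))
    ≈⟨ ⊕-cong (scale-distrib-⊕ x a b) (≈-trans (∷-cong (⊗-distribˡ-⊕ p a b)) (0∷-distrib-⊕ (p ⊗ a) (p ⊗ b))) ⟩
  (scale x a ⊕ scale x b) ⊕ ((0 ∷ (p ⊗ a)) ⊕ (0 ∷ (p ⊗ b)))
    ≈⟨ ⊕-interchange (scale x a) (scale x b) (0 ∷ (p ⊗ a)) (0 ∷ (p ⊗ b)) ⟩
  (scale x a ⊕ (0 ∷ (p ⊗ a))) ⊕ (scale x b ⊕ (0 ∷ (p ⊗ b))) ∎
  where open ≈-Reasoning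

⊗-distribʳ-⊕ : ∀ a b q → ((a ⊕ b) ⊗ q) ≈ ((a ⊗ q) ⊕ (b ⊗ q))
⊗-distribʳ-⊕ [] b q = ≈-refl
⊗-distribʳ-⊕ (x ∷ a) [] q = ≈-sym (⊕-identityʳ _)
⊗-distribʳ-⊕ (x ∷ a) (y ∷ b) q = begin
  scale (x + y) q ⊕ (0 ∷ ((a ⊕ b) ⊗ q))
    ≈⟨ ⊕-cong (scale-distrib-+ x y q) (≈-trans (∷-cong (⊗-distribʳ-⊕ a b q)) (0∷-distrib-⊕ (a ⊗ q) (b ⊗ q))) ⟩
  (scale x q ⊕ scale y q) ⊕ ((0 ∷ (a ⊗ q)) ⊕ (0 ∷ (b ⊗ q)))
    ≈⟨ ⊕-interchange (scale x q) (scale y q) (0 ∷ (a ⊗ q)) (0 ∷ (b ⊗ q)) ⟩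
  (scale x q ⊕ (0 ∷ (a ⊗ q))) ⊕ (scale y q ⊕ (0 ∷ (b ⊗ q))) ∎
  where open ≈-Reasoning

qpow-+ : ∀ a b → qpow (a + b) ≈ (qpow a ⊗ qpow b)
qpow-+ zero b = mk λ k → sym (trans (coeff-⊕ (scale 1 (qpow b)) (0 ∷ []) k)
                                    (trans (cong₂ _+_ (ap (scale-identity (qpow b)) k) (coeff-0∷[] k)) (+-identityʳ _)))
  where coeff-0∷[] : ∀ k → coeff (0 ∷ []) k ≡ 0
        coeff-0∷[] zero = refl
        coeff-0∷[] (suc k) = refl
qpow-+ (suc a) b = ≈-sym (≈-trans (⊕-cong (scale-zero (qpow b)) ≈-refl) (∷-cong (≈-sym (qpow-+ a b))))

module _ {A : Set} where
  sumP-cong : {f g : A → Poly} → (∀ x → f x ≈ g x) → ∀ L → sumP f L ≈ sumP g L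
  sumP-cong e [] = ≈-refl
  sumP-cong e (x ∷ L) = ⊕-cong (e x) (sumP-cong e L)

  sumP-congAll : {f g : A → Poly} → ∀ {L} → All (λ x → f x ≈ g x) L → sumP f L ≈ sumP g L
  sumP-congAll [] = ≈-refl
  sumP-congAll (e ∷ es) = ⊕-cong e (sumP-congAll es)

  sumP-⊕ : (f g : A → Poly) → ∀ L → sumP (λ x → f x ⊕ g x) L ≈ (sumP f L ⊕ sumP g L)
  sumP-⊕ f g [] = ≈-refl
  sumP-⊕ f g (x ∷ L) = ≈-trans (⊕-congʳ (f x ⊕ g x) (sumP-⊕ f g L)) (⊕-interchange (f x) (g x) (sumP f L) (sumP g L))

  sumP-++ : (f : A → Poly) → ∀ L M → sumP f (L ++ M) ≈ (sumP f L ⊕ sumP f M)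
  sumP-++ f [] M = ≈-refl
  sumP-++ f (x ∷ L) M = ≈-trans (⊕-congʳ (f x) (sumP-++ f L M)) (≈-sym (⊕-assoc (f x) (sumP f L) (sumP f M)))

  sumP-zero : (f : A → Poly) → (∀ x → f x ≈ []) → ∀ L → sumP f L ≈ []
  sumP-zero f e [] = ≈-refl
  sumP-zero f e (x ∷ L) = ⊕-cong (e x) (sumP-zero f e L)

  ⊗-sumP : ∀ p (f : A → Poly) → ∀ L → (p ⊗ sumP f L) ≈ sumP (λ x → p ⊗ f x) L
  ⊗-sumP p f [] = ⊗-zeroʳ p
  ⊗-sumP p f (x ∷ L) = ≈-trans (⊗-distribˡ-⊕ p (f x) (sumP f L)) (⊕-congʳ (p ⊗ f x) (⊗-sumP p f L))

  sumP-⊗ : ∀ p (f : A → Poly) → ∀ L → (sumP f L ⊗ p) ≈ sumP (λ x → f x ⊗ p) L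
  sumP-⊗ p f [] = ≈-refl
  sumP-⊗ p f (x ∷ L) = ≈-trans (⊗-distribʳ-⊕ (f x) (sumP f L) p) (⊕-congʳ (f x ⊗ p) (sumP-⊗ p f L))

  sumP-if : ∀ b (f : A → Poly) → ∀ L → sumP (λ x → if b then f x else []) L ≈ (if b then sumP f L else [])
  sumP-if true f L = ≈-refl
  sumP-if false f L = sumP-zero (λ _ → []) (λ _ → ≈-refl) L

  sumP-countᵇ : ∀ (g : A → Bool) Y L → sumP (λ x → if g x then Y else []) L ≈ scale (countᵇ g L) Y
  sumP-countᵇ g Y [] = ≈-sym (scale-zero Y)
  sumP-countᵇ g Y (x ∷ L) =
    ≈-trans (⊕-cong (if≈scale (g x)) (sumP-countᵇ g Y L)) (≈-sym (scale-distrib-+ (ι (g x)) (countᵇ g L) Y))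
    where if≈scale : ∀ b → (if b then Y else []) ≈ scale (ι b) Y
          if≈scale true = ≈-sym (scale-identity Y)
          if≈scale false = ≈-sym (scale-zero Y)

  sumP-filter : ∀ {ℓ} {P : Pred A ℓ} (P? : Decidable P) (f : A → Poly) → ∀ L →
    sumP f (filter P? L) ≈ sumP (λ x → if does (P? x) then f x else []) L
  sumP-filter P? f [] = ≈-refl
  sumP-filter P? f (x ∷ L) with does (P? x)
  ... | true = ⊕-congʳ (f x) (sumP-filter P? f L)
  ... | false = sumP-filter P? f L

module _ {A B : Set} where
  sumP-map : (f : B → Poly) (h : A → B) → ∀ L → sumP f (map h L) ≡ sumP (f ∘ h) L
  sumP-map f h [] = refl
  sumP-map f h (x ∷ L) = cong (f (h x) ⊕_) (sumP-map f h L)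

  sumP-concatMap : (f : B → Poly) (h : A → List B) → ∀ L → sumP f (concatMap h L) ≈ sumP (λ a → sumP f (h a)) L
  sumP-concatMap f h [] = ≈-refl
  sumP-concatMap f h (x ∷ L) = ≈-trans (sumP-++ f (h x) (concatMap h L)) (⊕-congʳ (sumP f (h x)) (sumP-concatMap f h L))

  sumP-swap : (f : A → B → Poly) → ∀ L M → sumP (λ a → sumP (λ b → f a b) M) L ≈ sumP (λ b → sumP (λ a → f a b) L) M
  sumP-swap f [] M = ≈-sym (sumP-zero (λ b → []) (λ _ → ≈-refl) M)
  sumP-swap f (x ∷ L) M = ≈-trans (⊕-congʳ (sumP (f x) M) (sumP-swap f L M)) (≈-sym (sumP-⊕ (f x) (λ b → sumP (λ a → f a b) L) M))

sumP-0∷ : ∀ {A : Set} (g : A → Poly) L → sumP (λ y → 0 ∷ g y) L ≈ (0 ∷ sumP g L)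
sumP-0∷ g [] = mk λ { zero → refl ; (suc k) → refl }
sumP-0∷ g (y ∷ L) = ⊕-congʳ (0 ∷ g y) (sumP-0∷ g L)

sumP-tabulate : ∀ {A : Set} n (f : A → Poly) (g : Fin n → A) → sumP f (tabulate g) ≡ sumP (f ∘ g) (allFin n)
sumP-tabulate zero f g = refl
sumP-tabulate (suc n) f g = cong (f (g fz) ⊕_) (trans (sumP-tabulate n f (g ∘ fs)) (sym (sumP-tabulate n (f ∘ g) fs)))

sumP-allFin-suc : ∀ n (f : Fin (suc n) → Poly) → sumP f (allFin (suc n)) ≡ (f fz ⊕ sumP (f ∘ fs) (allFin n))
sumP-allFin-suc n f = cong (f fz ⊕_) (sumP-tabulate n f fs)

sumP-at : ∀ n c → c < n → (h : Fin n → Poly) (Y : Poly) → (∀ a → toℕ a ≡ c → h a ≈ Y) →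
  sumP (λ a → if toℕ a ≡ᵇ c then h a else []) (allFin n) ≈ Y
sumP-at (suc n) zero c<n h Y e =
  ≈-trans (≡⇒≈ (sumP-allFin-suc n (λ a → if toℕ a ≡ᵇ zero then h a else [])))
          (≈-trans (⊕-cong (e fz refl) (sumP-zero _ (λ a → ≈-refl) (allFin n))) (⊕-identityʳ Y))
sumP-at (suc n) (suc c) (s≤s c<n) h Y e =
  ≈-trans (≡⇒≈ (sumP-allFin-suc n (λ a → if toℕ a ≡ᵇ suc c then h a else [])))
          (sumP-at n c c<n (h ∘ fs) Y (λ a eq → e (fs a) (cong suc eq)))

sumFin : ∀ n → (Fin n → ℕ) → ℕ
sumFin n h = sum (map h (allFin n))

sumFin-suc : ∀ n (h : Fin (suc n) → ℕ) → sumFin (suc n) h ≡ h fz + sumFin n (h ∘ fs)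
sumFin-suc n h = cong (λ xs → h fz + sum xs) (trans (map-tabulate fs h) (sym (map-tabulate (λ x → x) (h ∘ fs))))

sumFin-cong : ∀ n {g h : Fin n → ℕ} → (∀ x → g x ≡ h x) → sumFin n g ≡ sumFin n h
sumFin-cong zero e = refl
sumFin-cong (suc n) {g} {h} e = trans (sumFin-suc n g) (trans (cong₂ _+_ (e fz) (sumFin-cong n (e ∘ fs))) (sym (sumFin-suc n h)))

sumFin-+ : ∀ n (g h : Fin n → ℕ) → sumFin n (λ x → g x + h x) ≡ sumFin n g + sumFin n h
sumFin-+ zero g h = refl
sumFin-+ (suc n) g h = trans (sumFin-suc n _) (trans (cong (g fz + h fz +_) (sumFin-+ n (g ∘ fs) (h ∘ fs)))
  (trans (interchange (g fz) (h fz) _ _) (sym (cong₂ _+_ (sumFin-suc n g) (sumFin-suc n h)))))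

sumFin-* : ∀ n k (g : Fin n → ℕ) → sumFin n (λ x → k * g x) ≡ k * sumFin n g
sumFin-* zero k g = sym (*-zeroʳ k)
sumFin-* (suc n) k g = trans (sumFin-suc n _) (trans (cong (k * g fz +_) (sumFin-* n k (g ∘ fs)))
  (trans (sym (*-distribˡ-+ k (g fz) _)) (cong (k *_) (sym (sumFin-suc n g)))))

sumFin-zero : ∀ n → sumFin n (λ _ → 0) ≡ 0
sumFin-zero zero = refl
sumFin-zero (suc n) = trans (sumFin-suc n (λ _ → 0)) (sumFin-zero n)

sumFin-swap : ∀ n m (f : Fin n → Fin m → ℕ) →
  sumFin n (λ a → sumFin m (λ b → f a b)) ≡ sumFin m (λ b → sumFin n (λ a → f a b))
sumFin-swap zero m f = sym (sumFin-zero m)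
sumFin-swap (suc n) m f = trans (sumFin-suc n _) (trans (cong (sumFin m (f fz) +_) (sumFin-swap n m (f ∘ fs)))
  (trans (sym (sumFin-+ m (f fz) _)) (sumFin-cong m (λ b → sym (sumFin-suc n (λ a → f a b))))))

sumP-allVecs-suc : ∀ k n (f : Vec (Fin n) (suc k) → Poly) →
  sumP f (allVecs (suc k) n) ≈ sumP (λ a → sumP (λ v → f (a ∷ v)) (allVecs k n)) (allFin n)
sumP-allVecs-suc k n f =
  ≈-trans (sumP-concatMap f (λ a → map (a ∷_) (allVecs k n)) (allFin n))
          (sumP-cong (λ a → ≡⇒≈ (sumP-map f (a ∷_) (allVecs k n))) (allFin n))

countᵇ-cong : ∀ {A : Set} {f g : A → Bool} → (∀ y → f y ≡ g y) → ∀ L → countᵇ f L ≡ countᵇ g L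
countᵇ-cong e [] = refl
countᵇ-cong e (x ∷ L) = cong₂ _+_ (cong ι (e x)) (countᵇ-cong e L)

countᵇ-congAll : ∀ {A : Set} {f g : A → Bool} {L} → All (λ y → f y ≡ g y) L → countᵇ f L ≡ countᵇ g L
countᵇ-congAll [] = refl
countᵇ-congAll (e ∷ es) = cong₂ _+_ (cong ι e) (countᵇ-congAll es)

countᵇ-none : ∀ {A : Set} (f : A → Bool) L → All (λ y → f y ≡ false) L → countᵇ f L ≡ 0
countᵇ-none f [] [] = refl
countᵇ-none f (x ∷ L) (e ∷ es) rewrite e = countᵇ-none f L es

countᵇ-tabulate : ∀ {A : Set} n (g : A → Bool) (f : Fin n → A) → countᵇ g (tabulate f) ≡ countᵇ (g ∘ f) (allFin n)
countᵇ-tabulate zero g f = refl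
countᵇ-tabulate (suc n) g f = cong (ι (g (f fz)) +_) (trans (countᵇ-tabulate n g (f ∘ fs)) (sym (countᵇ-tabulate n (g ∘ f) fs)))

countᵇ-allFin-suc : ∀ n (g : Fin (suc n) → Bool) → countᵇ g (allFin (suc n)) ≡ ι (g fz) + countᵇ (g ∘ fs) (allFin n)
countᵇ-allFin-suc n g = cong (ι (g fz) +_) (countᵇ-tabulate n g fs)

countᵇ-false : ∀ n → countᵇ {Fin n} (λ _ → false) (allFin n) ≡ 0
countᵇ-false zero = refl
countᵇ-false (suc n) = trans (countᵇ-allFin-suc n (λ _ → false)) (countᵇ-false n)

-- Reading a vector as an arc diagram

values : ∀ {n k} → Vec (Fin n) k → List ℕ
values [] = []
values (a ∷ v) = toℕ a ∷ values v

elem : ℕ → List ℕ → Bool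
elem a [] = false
elem a (x ∷ xs) = (a ≡ᵇ x) ∨ elem a xs

remove : ℕ → List ℕ → List ℕ
remove a [] = []
remove a (x ∷ xs) = if a ≡ᵇ x then xs else x ∷ remove a xs

hasAt : List ℕ → ℕ → ℕ → Bool
hasAt [] j y = false
hasAt (x ∷ xs) zero y = x ≡ᵇ y
hasAt (x ∷ xs) (suc j) y = hasAt xs j y

-- completes p X v: v lists the values σ(p), σ(p+1), … of a map whose arcs opened
-- before p and not yet closed are those starting at the positions in X.  Each value
-- either closes one of these arcs or opens the arc (p, a), whose right end a must
-- then map back to p.
completes : ℕ → List ℕ → List ℕ → Bool
completes p X [] = null X
completes p X (a ∷ v) =
  if a <ᵇ p then elem a X ∧ completes (suc p) (remove a X) v
  else (if a ≡ᵇ p then false else completes (suc p) (p ∷ X) v ∧ hasAt v (a ∸ suc p) p)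

-- Closing the arc (a, p) counts the arcs (y, p') with a < y < p < p'.
closingWeight : ℕ → List ℕ → ℕ
closingWeight p [] = 0
closingWeight p (a ∷ v) =
  (if a <ᵇ p then countᵇ (λ y → (y <ᵇ p) ∧ (a <ᵇ y)) v else 0) + closingWeight (suc p) v

Descending : List ℕ → Set
Descending [] = ⊤
Descending (x ∷ xs) = All (_< x) xs × Descending xs

All-remove : ∀ {Q : ℕ → Set} a {X} → All Q X → All Q (remove a X)
All-remove a {[]} [] = []
All-remove a {x ∷ X} (q ∷ qs) with a ≡ᵇ x
... | true = qs
... | false = q ∷ All-remove a qs

countᵇ-remove : ∀ (P : ℕ → Bool) a X → elem a X ≡ true → ι (P a) + countᵇ P (remove a X) ≡ countᵇ P X
countᵇ-remove P a (x ∷ X) m with a ≡ᵇ x in eq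
... | true = cong (λ z → ι (P z) + countᵇ P X) (≡ᵇ-true⁻¹ eq)
... | false = begin
  ι (P a) + (ι (P x) + countᵇ P (remove a X))  ≡⟨ +-assoc (ι (P a)) _ _ ⟨
  ι (P a) + ι (P x) + countᵇ P (remove a X)    ≡⟨ cong (_+ countᵇ P (remove a X)) (+-comm (ι (P a)) (ι (P x))) ⟩
  ι (P x) + ι (P a) + countᵇ P (remove a X)    ≡⟨ +-assoc (ι (P x)) _ _ ⟩
  ι (P x) + (ι (P a) + countᵇ P (remove a X))  ≡⟨ cong (ι (P x) +_) (countᵇ-remove P a X m) ⟩
  ι (P x) + countᵇ P X                         ∎
  where open ≡-Reasoning

length-remove : ∀ a X → elem a X ≡ true → suc (length (remove a X)) ≡ length X
length-remove a (x ∷ X) m with a ≡ᵇ x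
... | true = refl
... | false = cong suc (length-remove a X m)

All-<-suc : ∀ {p X} → All (_< p) X → All (_< suc p) X
All-<-suc = All.map (λ q → <-trans q (n<1+n _))

-- Every open arc is closed exactly once by the remaining values.
completes-countᵇ : ∀ p X v (P : ℕ → Bool) → All (_< p) X → completes p X v ≡ true →
                   countᵇ (λ y → (y <ᵇ p) ∧ P y) v ≡ countᵇ P X
completes-countᵇ p [] [] P X<p r = refl
completes-countᵇ p X (b ∷ v) P X<p r with b <ᵇ p
... | true = begin
  ι (P b) + countᵇ (λ y → (y <ᵇ p) ∧ P y) v
    ≡⟨ cong (ι (P b) +_) (countᵇ-cong (λ y → <ᵇ-suc-∧ y p (P y)) v) ⟨
  ι (P b) + countᵇ (λ y → (y <ᵇ suc p) ∧ ((y <ᵇ p) ∧ P y)) v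
    ≡⟨ cong (ι (P b) +_) (completes-countᵇ (suc p) (remove b X) v (λ y → (y <ᵇ p) ∧ P y)
                            (All-<-suc (All-remove b X<p)) (proj₂ (∧-true⁻¹ r))) ⟩
  ι (P b) + countᵇ (λ y → (y <ᵇ p) ∧ P y) (remove b X)
    ≡⟨ cong (ι (P b) +_) (countᵇ-congAll (All.map (λ {y} y<p → cong (_∧ P y) (<ᵇ-true y<p)) (All-remove b X<p))) ⟩
  ι (P b) + countᵇ P (remove b X)
    ≡⟨ countᵇ-remove P b X (proj₁ (∧-true⁻¹ r)) ⟩
  countᵇ P X ∎
  where open ≡-Reasoning
... | false with b ≡ᵇ p
... | true = ⊥-elim (true≢false (sym r))
... | false = begin
  countᵇ (λ y → (y <ᵇ p) ∧ P y) v
    ≡⟨ countᵇ-cong (λ y → <ᵇ-suc-∧ y p (P y)) v ⟨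
  countᵇ (λ y → (y <ᵇ suc p) ∧ ((y <ᵇ p) ∧ P y)) v
    ≡⟨ completes-countᵇ (suc p) (p ∷ X) v (λ y → (y <ᵇ p) ∧ P y) (n<1+n p ∷ All-<-suc X<p) (proj₁ (∧-true⁻¹ r)) ⟩
  ι ((p <ᵇ p) ∧ P p) + countᵇ (λ y → (y <ᵇ p) ∧ P y) X
    ≡⟨ cong₂ _+_ (cong (λ z → ι (z ∧ P p)) (<ᵇ-false {p} ≤-refl))
                 (countᵇ-congAll (All.map (λ {x} x<p → cong (_∧ P x) (<ᵇ-true x<p)) X<p)) ⟩
  countᵇ P X ∎
  where open ≡-Reasoning

-- Arc diagrams are counted by weighted walks

walks : ℕ → ℕ → Poly
walks zero zero = oneP
walks zero (suc s) = []
walks (suc k) s = walks k (suc s) ⊕ (qint s ⊗ walks k (s ∸ 1))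

walks-unreachable : ∀ k s → k < s → walks k s ≈ []
walks-unreachable zero (suc s) _ = ≈-refl
walks-unreachable (suc k) s k<s =
  ⊕-cong (walks-unreachable k (suc s) (<-trans (<-trans (n<1+n k) k<s) (n<1+n s)))
         (≈-trans (⊗-congʳ (qint s) (walks-unreachable k (s ∸ 1) (∸-monoˡ-< {suc k} {1} {s} k<s (s≤s z≤n))))
                  (⊗-zeroʳ (qint s)))

countᵇ-hasAt : ∀ n w y → length w ≤ n → countᵇ (λ a → hasAt w (toℕ a) y) (allFin n) ≡ countᵇ (_≡ᵇ y) w
countᵇ-hasAt n [] y _ = countᵇ-false n
countᵇ-hasAt (suc n) (x ∷ w) y (s≤s l) =
  trans (countᵇ-allFin-suc n (λ a → hasAt (x ∷ w) (toℕ a) y)) (cong (ι (x ≡ᵇ y) +_) (countᵇ-hasAt n w y l))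

countᵇ-hasAt-after : ∀ n p w y → suc p + length w ≤ n →
  countᵇ (λ a → (p <ᵇ toℕ a) ∧ hasAt w (toℕ a ∸ suc p) y) (allFin n) ≡ countᵇ (_≡ᵇ y) w
countᵇ-hasAt-after (suc n) zero w y (s≤s l) =
  trans (countᵇ-allFin-suc n (λ a → (zero <ᵇ toℕ a) ∧ hasAt w (toℕ a ∸ 1) y)) (countᵇ-hasAt n w y l)
countᵇ-hasAt-after (suc n) (suc p) w y (s≤s l) =
  trans (countᵇ-allFin-suc n (λ a → (suc p <ᵇ toℕ a) ∧ hasAt w (toℕ a ∸ suc (suc p)) y)) (countᵇ-hasAt-after n p w y l)

elem⇒< : ∀ {a p} X → All (_< p) X → elem a X ≡ true → a < p
elem⇒< {a} (x ∷ X) (q ∷ qs) m with a ≡ᵇ x in e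
... | true = subst (_< _) (sym (≡ᵇ-true⁻¹ e)) q
... | false = elem⇒< X qs m

elem-bound : ∀ {a p} X → All (_< p) X → p ≤ a → elem a X ≡ false
elem-bound {a} X X<p p≤a with elem a X in e
... | true = ⊥-elim (<⇒≱ (elem⇒< X X<p e) p≤a)
... | false = refl

Descending-remove : ∀ a X → Descending X → Descending (remove a X)
Descending-remove a [] d = tt
Descending-remove a (x ∷ X) (q , d) with a ≡ᵇ x
... | true = d
... | false = All-remove a q , Descending-remove a X d

openedAfter : List ℕ → ℕ → ℕ
openedAfter X y = countᵇ (y <ᵇ_) (remove y X)

-- The arcs opened after x are the larger entries of X, so the exponents are 0, 1, …, |X| − 1.
sumP-qpow-openedAfter : ∀ X → Descending X → sumP (λ y → qpow (openedAfter X y)) X ≈ qint (length X)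
sumP-qpow-openedAfter [] d = ≈-refl
sumP-qpow-openedAfter (x ∷ X) (X<x , d) rewrite ≡ᵇ-refl x =
  ⊕-cong (≡⇒≈ (cong qpow (countᵇ-none (x <ᵇ_) X (All.map (λ y<x → <ᵇ-false (<⇒≤ y<x)) X<x))))
    (begin
      sumP (λ y → qpow (openedAfter (x ∷ X) y)) X
        ≈⟨ sumP-congAll (All.map (λ {y} y<x → ≡⇒≈ (cong qpow (openedAfter-∷ y y<x))) X<x) ⟩
      sumP (λ y → 0 ∷ qpow (openedAfter X y)) X
        ≈⟨ sumP-0∷ (λ y → qpow (openedAfter X y)) X ⟩
      0 ∷ sumP (λ y → qpow (openedAfter X y)) X
        ≈⟨ ∷-cong (sumP-qpow-openedAfter X d) ⟩
      0 ∷ qint (length X) ∎)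
  where
    open ≈-Reasoning
    openedAfter-∷ : ∀ y → y < x → openedAfter (x ∷ X) y ≡ suc (openedAfter X y)
    openedAfter-∷ y y<x rewrite ≡ᵇ-false {y} {x} (<⇒≢ y<x) | <ᵇ-true y<x = refl

if-∨-disjoint : ∀ b c (Y : Poly) → (b ≡ true → c ≡ false) →
  (if b ∨ c then Y else []) ≈ ((if b then Y else []) ⊕ (if c then Y else []))
if-∨-disjoint true true Y f = ⊥-elim (true≢false (f refl))
if-∨-disjoint true false Y f = ≈-sym (⊕-identityʳ Y)
if-∨-disjoint false true Y f = ≈-refl
if-∨-disjoint false false Y f = ≈-refl

if-∧ : ∀ b c (Y : Poly) → (if b ∧ c then Y else []) ≈ (if c then (if b then Y else []) else [])
if-∧ true true Y = ≈-refl
if-∧ true false Y = ≈-refl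
if-∧ false true Y = ≈-refl
if-∧ false false Y = ≈-refl

sumP-elem : ∀ n (h : ℕ → Poly) X → Descending X → All (_< n) X →
  sumP (λ a → if elem (toℕ a) X then h (toℕ a) else []) (allFin n) ≈ sumP h X
sumP-elem n h [] d X<n = sumP-zero _ (λ _ → ≈-refl) (allFin n)
sumP-elem n h (x ∷ X) (X<x , d) (x<n ∷ X<n) =
  ≈-trans (sumP-cong split (allFin n))
  (≈-trans (sumP-⊕ _ _ (allFin n))
  (⊕-cong (sumP-at n x x<n (λ a → h (toℕ a)) (h x) (λ a e → ≡⇒≈ (cong h e))) (sumP-elem n h X d X<n)))
  where
    split : ∀ (a : Fin n) → (if elem (toℕ a) (x ∷ X) then h (toℕ a) else []) ≈
               ((if toℕ a ≡ᵇ x then h (toℕ a) else []) ⊕ (if elem (toℕ a) X then h (toℕ a) else []))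
    split a = if-∨-disjoint (toℕ a ≡ᵇ x) (elem (toℕ a) X) (h (toℕ a))
                (λ e → elem-bound X X<x (≤-reflexive (sym (≡ᵇ-true⁻¹ e))))

length-values : ∀ {n k} (v : Vec (Fin n) k) → length (values v) ≡ k
length-values [] = refl
length-values (a ∷ v) = cong suc (length-values v)

completes-opens-once : ∀ p X w → All (_< p) X → completes (suc p) (p ∷ X) w ≡ true → countᵇ (_≡ᵇ p) w ≡ 1
completes-opens-once p X w X<p r = begin
  countᵇ (_≡ᵇ p) w
    ≡⟨ countᵇ-cong (λ y → ≡ᵇ-<ᵇ-suc y p) w ⟩
  countᵇ (λ y → (y <ᵇ suc p) ∧ (y ≡ᵇ p)) w
    ≡⟨ completes-countᵇ (suc p) (p ∷ X) w (_≡ᵇ p) (n<1+n p ∷ All-<-suc X<p) r ⟩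
  ι (p ≡ᵇ p) + countᵇ (_≡ᵇ p) X
    ≡⟨ cong₂ _+_ (cong ι (≡ᵇ-refl p)) (countᵇ-none (_≡ᵇ p) X (All.map (λ q → ≡ᵇ-false (<⇒≢ q)) X<p)) ⟩
  1 ∎
  where open ≡-Reasoning

module Diagrams (n : ℕ) where

  weight : ℕ → List ℕ → ∀ {k} → Vec (Fin n) k → Poly
  weight p X v = if completes p X (values v) then qpow (closingWeight p (values v)) else []

  completionSum : ℕ → ℕ → List ℕ → Poly
  completionSum k p X = sumP (weight p X) (allVecs k n)

  module FirstValue (k p : ℕ) (X : List ℕ) (X<p : All (_< p) X) where
    closeTerm : Fin n → Vec (Fin n) k → Poly
    closeTerm a v =
      if elem (toℕ a) X then qpow (openedAfter X (toℕ a)) ⊗ weight (suc p) (remove (toℕ a) X) v else []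

    openTerm : Fin n → Vec (Fin n) k → Poly
    openTerm a v = if (p <ᵇ toℕ a) ∧ hasAt (values v) (toℕ a ∸ suc p) p then weight (suc p) (p ∷ X) v else []

    crossings-closed : ∀ a w → completes (suc p) (remove a X) w ≡ true →
                       countᵇ (λ y → (y <ᵇ p) ∧ (a <ᵇ y)) w ≡ openedAfter X a
    crossings-closed a w r = begin
      countᵇ (λ y → (y <ᵇ p) ∧ (a <ᵇ y)) w
        ≡⟨ countᵇ-cong (λ y → <ᵇ-suc-∧ y p (a <ᵇ y)) w ⟨
      countᵇ (λ y → (y <ᵇ suc p) ∧ ((y <ᵇ p) ∧ (a <ᵇ y))) w
        ≡⟨ completes-countᵇ (suc p) (remove a X) w (λ y → (y <ᵇ p) ∧ (a <ᵇ y)) (All-<-suc (All-remove a X<p)) r ⟩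
      countᵇ (λ y → (y <ᵇ p) ∧ (a <ᵇ y)) (remove a X)
        ≡⟨ countᵇ-congAll (All.map (λ {y} y<p → cong (_∧ (a <ᵇ y)) (<ᵇ-true y<p)) (All-remove a X<p)) ⟩
      openedAfter X a ∎
      where open ≡-Reasoning

    weight-close : ∀ (a : Fin n) (v : Vec (Fin n) k) →
      (if elem (toℕ a) X ∧ completes (suc p) (remove (toℕ a) X) (values v)
       then qpow (countᵇ (λ y → (y <ᵇ p) ∧ (toℕ a <ᵇ y)) (values v) + closingWeight (suc p) (values v)) else [])
      ≈ closeTerm a v
    weight-close a v with elem (toℕ a) X
    ... | false = ≈-refl
    ... | true with completes (suc p) (remove (toℕ a) X) (values v) in r
    ...   | false = ≈-sym (⊗-zeroʳ (qpow (openedAfter X (toℕ a))))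
    ...   | true = ≈-trans (≡⇒≈ (cong (λ z → qpow (z + closingWeight (suc p) (values v))) (crossings-closed (toℕ a) (values v) r)))
                           (qpow-+ (openedAfter X (toℕ a)) (closingWeight (suc p) (values v)))

    weight-∷ : ∀ (a : Fin n) (v : Vec (Fin n) k) → weight p X (a ∷ v) ≈ (closeTerm a v ⊕ openTerm a v)
    weight-∷ a v with toℕ a <ᵇ p in a<p
    ... | true rewrite <ᵇ-false {p} {toℕ a} (<⇒≤ (<ᵇ-true⁻¹ a<p)) =
      ≈-trans (weight-close a v) (≈-sym (⊕-identityʳ (closeTerm a v)))
    ... | false rewrite elem-bound X X<p (<ᵇ-false⁻¹ a<p) with toℕ a ≡ᵇ p in a≡p
    ...   | true rewrite <ᵇ-false {p} {toℕ a} (≤-reflexive (≡ᵇ-true⁻¹ a≡p)) = ≈-refl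
    ...   | false rewrite <ᵇ-true {p} {toℕ a} (≤∧≢⇒< (<ᵇ-false⁻¹ a<p) (λ e → ≡ᵇ-false⁻¹ a≡p (sym e))) =
      if-∧ (completes (suc p) (p ∷ X) (values v)) (hasAt (values v) (toℕ a ∸ suc p) p) (qpow (closingWeight (suc p) (values v)))

  completionSum≈walks : ∀ k p X → Descending X → All (_< p) X → p + k ≤ n → completionSum k p X ≈ walks k (length X)
  completionSum≈walks zero p [] d X<p le = ≈-refl
  completionSum≈walks zero p (x ∷ X) d X<p le = ≈-refl
  completionSum≈walks (suc k) p X d X<p le = begin
    completionSum (suc k) p X
      ≈⟨ sumP-allVecs-suc k n (weight p X) ⟩
    sumP (λ a → sumP (λ v → weight p X (a ∷ v)) Vs) (allFin n)
      ≈⟨ sumP-cong (λ a → ≈-trans (sumP-cong (weight-∷ a) Vs) (sumP-⊕ (closeTerm a) (openTerm a) Vs)) (allFin n) ⟩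
    sumP (λ a → sumP (closeTerm a) Vs ⊕ sumP (openTerm a) Vs) (allFin n)
      ≈⟨ sumP-⊕ (λ a → sumP (closeTerm a) Vs) (λ a → sumP (openTerm a) Vs) (allFin n) ⟩
    sumP (λ a → sumP (closeTerm a) Vs) (allFin n) ⊕ sumP (λ a → sumP (openTerm a) Vs) (allFin n)
      ≈⟨ ⊕-cong closing opening ⟩
    (qint s ⊗ walks k (s ∸ 1)) ⊕ walks k (suc s)
      ≈⟨ ⊕-comm (qint s ⊗ walks k (s ∸ 1)) (walks k (suc s)) ⟩
    walks (suc k) s ∎
    where
      open ≈-Reasoning
      open FirstValue k p X X<p
      Vs : List (Vec (Fin n) k)
      Vs = allVecs k n
      s : ℕ
      s = length X
      le' : suc p + k ≤ n
      le' = subst (_≤ n) (+-suc p k) le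
      X<n : All (_< n) X
      X<n = All.map (λ q → <-≤-trans q (≤-trans (m≤m+n p (suc k)) le)) X<p

      close-walks : ∀ (a : Fin n) b → elem (toℕ a) X ≡ b →
        (if b then sumP (λ v → qpow (openedAfter X (toℕ a)) ⊗ weight (suc p) (remove (toℕ a) X) v) Vs else [])
        ≈ ((if b then qpow (openedAfter X (toℕ a)) else []) ⊗ walks k (s ∸ 1))
      close-walks a false m = ≈-refl
      close-walks a true m =
        ≈-trans (≈-sym (⊗-sumP (qpow (openedAfter X (toℕ a))) (weight (suc p) (remove (toℕ a) X)) Vs))
          (⊗-congʳ (qpow (openedAfter X (toℕ a)))
            (≈-trans (completionSum≈walks k (suc p) (remove (toℕ a) X) (Descending-remove (toℕ a) X d)
                        (All-<-suc (All-remove (toℕ a) X<p)) le')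
                    (≡⇒≈ (cong (walks k) (cong (_∸ 1) (length-remove (toℕ a) X m))))))

      closing : sumP (λ a → sumP (closeTerm a) Vs) (allFin n) ≈ (qint s ⊗ walks k (s ∸ 1))
      closing = begin
        sumP (λ a → sumP (closeTerm a) Vs) (allFin n)
          ≈⟨ sumP-cong (λ a → ≈-trans (sumP-if (elem (toℕ a) X) _ Vs) (close-walks a (elem (toℕ a) X) refl)) (allFin n) ⟩
        sumP (λ a → (if elem (toℕ a) X then qpow (openedAfter X (toℕ a)) else []) ⊗ walks k (s ∸ 1)) (allFin n)
          ≈⟨ sumP-⊗ (walks k (s ∸ 1)) (λ a → if elem (toℕ a) X then qpow (openedAfter X (toℕ a)) else []) (allFin n) ⟨
        sumP (λ a → if elem (toℕ a) X then qpow (openedAfter X (toℕ a)) else []) (allFin n) ⊗ walks k (s ∸ 1)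
          ≈⟨ ⊗-congˡ (walks k (s ∸ 1)) (sumP-elem n (λ y → qpow (openedAfter X y)) X d X<n) ⟩
        sumP (λ y → qpow (openedAfter X y)) X ⊗ walks k (s ∸ 1)
          ≈⟨ ⊗-congˡ (walks k (s ∸ 1)) (sumP-qpow-openedAfter X d) ⟩
        qint s ⊗ walks k (s ∸ 1) ∎

      -- the right end of the arc opened at p is determined by the remaining values
      partner-unique : ∀ (v : Vec (Fin n) k) b → completes (suc p) (p ∷ X) (values v) ≡ b →
        scale (countᵇ (λ a → (p <ᵇ toℕ a) ∧ hasAt (values v) (toℕ a ∸ suc p) p) (allFin n))
              (if b then qpow (closingWeight (suc p) (values v)) else [])
        ≈ (if b then qpow (closingWeight (suc p) (values v)) else [])
      partner-unique v false r = ≈-refl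
      partner-unique v true r =
        ≈-trans (≡⇒≈ (cong (λ c → scale c (qpow (closingWeight (suc p) (values v))))
                  (trans (countᵇ-hasAt-after n p (values v) p (subst (λ z → suc p + z ≤ n) (sym (length-values v)) le'))
                         (completes-opens-once p X (values v) X<p r))))
                (scale-identity _)

      opening : sumP (λ a → sumP (openTerm a) Vs) (allFin n) ≈ walks k (suc s)
      opening = begin
        sumP (λ a → sumP (openTerm a) Vs) (allFin n)
          ≈⟨ sumP-swap openTerm (allFin n) Vs ⟩
        sumP (λ v → sumP (λ a → openTerm a v) (allFin n)) Vs
          ≈⟨ sumP-cong (λ v → ≈-trans (sumP-countᵇ (λ a → (p <ᵇ toℕ a) ∧ hasAt (values v) (toℕ a ∸ suc p) p)
                                                    (weight (suc p) (p ∷ X) v) (allFin n))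
                                      (partner-unique v (completes (suc p) (p ∷ X) (values v)) refl)) Vs ⟩
        completionSum k (suc p) (p ∷ X)
          ≈⟨ completionSum≈walks k (suc p) (p ∷ X) (X<p , d) (n<1+n p ∷ All-<-suc X<p) le' ⟩
        walks k (suc s) ∎

-- Complete arc diagrams are fixed-point-free involutions

nth : List ℕ → ℕ → ℕ
nth [] _ = 0
nth (x ∷ xs) zero = x
nth (x ∷ xs) (suc i) = nth xs i

hasAt⇒nth : ∀ w j y → hasAt w j y ≡ true → (j < length w) × (nth w j ≡ y)
hasAt⇒nth (x ∷ w) zero y e = s≤s z≤n , ≡ᵇ-true⁻¹ e
hasAt⇒nth (x ∷ w) (suc j) y e with hasAt⇒nth w j y e
... | l , q = s≤s l , q

nth⇒countᵇ-pos : ∀ w i y → i < length w → nth w i ≡ y → 0 < countᵇ (_≡ᵇ y) w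
nth⇒countᵇ-pos (x ∷ w) zero y l e rewrite e | ≡ᵇ-refl y = s≤s z≤n
nth⇒countᵇ-pos (x ∷ w) (suc i) y (s≤s l) e = ≤-trans (nth⇒countᵇ-pos w i y l e) (m≤n+m _ (ι (x ≡ᵇ y)))

countᵇ-≡1⇒nth-injective : ∀ w y → countᵇ (_≡ᵇ y) w ≡ 1 → ∀ i j → i < length w → j < length w →
                           nth w i ≡ y → nth w j ≡ y → i ≡ j
countᵇ-≡1⇒nth-injective (x ∷ w) y c zero zero li lj ei ej = refl
countᵇ-≡1⇒nth-injective (x ∷ w) y c zero (suc j) li (s≤s lj) refl ej rewrite ≡ᵇ-refl x =
  ⊥-elim (<⇒≢ (nth⇒countᵇ-pos w j x lj ej) (sym (suc-injective c)))
countᵇ-≡1⇒nth-injective (x ∷ w) y c (suc i) zero (s≤s li) lj ei refl rewrite ≡ᵇ-refl x =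
  ⊥-elim (<⇒≢ (nth⇒countᵇ-pos w i x li ei) (sym (suc-injective c)))
countᵇ-≡1⇒nth-injective (x ∷ w) y c (suc i) (suc j) (s≤s li) (s≤s lj) ei ej with x ≡ᵇ y
... | true = ⊥-elim (<⇒≢ (nth⇒countᵇ-pos w i y li ei) (sym (suc-injective c)))
... | false = cong suc (countᵇ-≡1⇒nth-injective w y c i j li lj ei ej)

completes-closed-absent : ∀ p Y w → All (_< p) Y → completes (suc p) Y w ≡ true → countᵇ (_≡ᵇ p) w ≡ 0
completes-closed-absent p Y w Y<p r = begin
  countᵇ (_≡ᵇ p) w                          ≡⟨ countᵇ-cong (λ y → ≡ᵇ-<ᵇ-suc y p) w ⟩
  countᵇ (λ y → (y <ᵇ suc p) ∧ (y ≡ᵇ p)) w  ≡⟨ completes-countᵇ (suc p) Y w (_≡ᵇ p) (All-<-suc Y<p) r ⟩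
  countᵇ (_≡ᵇ p) Y                          ≡⟨ countᵇ-none (_≡ᵇ p) Y (All.map (λ q → ≡ᵇ-false (<⇒≢ q)) Y<p) ⟩
  0 ∎
  where open ≡-Reasoning

completes⇒no-fixed-point : ∀ p X v → completes p X v ≡ true → All (_< p) X → ∀ i → i < length v → nth v i ≢ p + i
completes⇒no-fixed-point p X (b ∷ v) r X<p zero l with b <ᵇ p in b<p
... | true = λ e → <-irrefl (trans e (+-identityʳ p)) (<ᵇ-true⁻¹ b<p)
... | false with b ≡ᵇ p in b≡p
... | true = ⊥-elim (true≢false (sym r))
... | false = λ e → ≡ᵇ-false⁻¹ b≡p (trans e (+-identityʳ p))
completes⇒no-fixed-point p X (b ∷ v) r X<p (suc i) (s≤s l) with b <ᵇ p
... | true = λ e → completes⇒no-fixed-point (suc p) (remove b X) v (proj₂ (∧-true⁻¹ r))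
                     (All-<-suc (All-remove b X<p)) i l (trans e (+-suc p i))
... | false with b ≡ᵇ p
... | true = ⊥-elim (true≢false (sym r))
... | false = λ e → completes⇒no-fixed-point (suc p) (p ∷ X) v (proj₁ (∧-true⁻¹ r))
                      (n<1+n p ∷ All-<-suc X<p) i l (trans e (+-suc p i))

∸-suc : ∀ p y → suc p ≤ y → y ∸ p ≡ suc (y ∸ suc p)
∸-suc zero (suc y) _ = refl
∸-suc (suc p) (suc y) (s≤s le) = ∸-suc p y le

-- Absolute positions: the entry at index i of v sits at position p + i.
Partner : ℕ → List ℕ → ℕ → Set
Partner p v i = (nth v i ∸ p < length v) × (nth v (nth v i ∸ p) ≡ p + i)

Partner-∷ : ∀ p b v i → p < nth v i → Partner (suc p) v i → Partner p (b ∷ v) (suc i)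
Partner-∷ p b v i p<y (l , e) =
  subst (_< suc (length v)) (sym (∸-suc p (nth v i) p<y)) (s≤s l) ,
  trans (cong (nth (b ∷ v)) (∸-suc p (nth v i) p<y)) (trans e (sym (+-suc p i)))

completes⇒involutive : ∀ p X v → completes p X v ≡ true → All (_< p) X →
                        ∀ i → i < length v → p ≤ nth v i → Partner p v i
completes⇒involutive p X (b ∷ v) r X<p zero l p≤b with b <ᵇ p in b<p
... | true = ⊥-elim (<⇒≱ (<ᵇ-true⁻¹ b<p) p≤b)
... | false with b ≡ᵇ p in b≡p
... | true = ⊥-elim (true≢false (sym r))
... | false with hasAt⇒nth v (b ∸ suc p) p (proj₂ (∧-true⁻¹ r))
... | l' , e' =
  subst (_< suc (length v)) (sym (∸-suc p b p<b)) (s≤s l') ,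
  trans (cong (nth (b ∷ v)) (∸-suc p b p<b)) (trans e' (sym (+-identityʳ p)))
  where p<b = ≤∧≢⇒< p≤b (λ e → ≡ᵇ-false⁻¹ b≡p (sym e))
completes⇒involutive p X (b ∷ v) r X<p (suc i) (s≤s l) p≤y with b <ᵇ p in b<p | m≤n⇒m<n∨m≡n p≤y
... | true | inj₁ p<y =
  Partner-∷ p b v i p<y
    (completes⇒involutive (suc p) (remove b X) v (proj₂ (∧-true⁻¹ r)) (All-<-suc (All-remove b X<p)) i l p<y)
... | true | inj₂ p≡y =
  ⊥-elim (<⇒≢ (nth⇒countᵇ-pos v i p l (sym p≡y))
                (sym (completes-closed-absent p (remove b X) v (All-remove b X<p) (proj₂ (∧-true⁻¹ r)))))
... | false | p≤y' with b ≡ᵇ p in b≡p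
... | true = ⊥-elim (true≢false (sym r))
... | false with p≤y'
...   | inj₁ p<y =
  Partner-∷ p b v i p<y
    (completes⇒involutive (suc p) (p ∷ X) v (proj₁ (∧-true⁻¹ r)) (n<1+n p ∷ All-<-suc X<p) i l p<y)
...   | inj₂ p≡y with hasAt⇒nth v (b ∸ suc p) p (proj₂ (∧-true⁻¹ r))
...     | l' , e' =
  subst (_< suc (length v)) (sym y∸p≡0) (s≤s z≤n) ,
  trans (cong (nth (b ∷ v)) y∸p≡0)
        (sym (trans (cong (λ z → p + suc z) i≡j) (trans (+-suc p (b ∸ suc p)) (m+[n∸m]≡n p<b))))
  where
    y∸p≡0 : nth v i ∸ p ≡ 0
    y∸p≡0 = trans (cong (_∸ p) (sym p≡y)) (n∸n≡0 p)
    p<b : p < b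
    p<b = ≤∧≢⇒< (<ᵇ-false⁻¹ b<p) (λ e → ≡ᵇ-false⁻¹ b≡p (sym e))
    -- p occurs once among the later values, at the right end b of the arc opened at p
    i≡j : i ≡ b ∸ suc p
    i≡j = countᵇ-≡1⇒nth-injective v p (completes-opens-once p X v X<p (proj₁ (∧-true⁻¹ r)))
            i (b ∸ suc p) l l' (sym p≡y) e'

-- Fixed-point-free involutions are complete arc diagrams

drop-nth : ∀ p (L : List ℕ) → p < length L → drop p L ≡ nth L p ∷ drop (suc p) L
drop-nth zero (x ∷ L) l = refl
drop-nth (suc p) (x ∷ L) (s≤s l) = drop-nth p L l

drop-length : ∀ (L : List ℕ) → drop (length L) L ≡ []
drop-length [] = refl
drop-length (x ∷ L) = drop-length L

nth-drop : ∀ q k (L : List ℕ) → nth (drop q L) k ≡ nth L (q + k)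
nth-drop zero k L = refl
nth-drop (suc q) k [] = refl
nth-drop (suc q) k (x ∷ L) = nth-drop q k L

nth⇒hasAt : ∀ w k y → k < length w → nth w k ≡ y → hasAt w k y ≡ true
nth⇒hasAt (x ∷ w) zero y l e rewrite e = ≡ᵇ-refl y
nth⇒hasAt (x ∷ w) (suc k) y (s≤s l) e = nth⇒hasAt w k y l e

filterᵇ-downFrom-cong : ∀ p {f g : ℕ → Bool} → (∀ x → x < p → f x ≡ g x) →
                        filterᵇ f (downFrom p) ≡ filterᵇ g (downFrom p)
filterᵇ-downFrom-cong zero e = refl
filterᵇ-downFrom-cong (suc p) {f} {g} e rewrite e p (n<1+n p) with g p
... | true = cong (p ∷_) (filterᵇ-downFrom-cong p (λ x l → e x (<-trans l (n<1+n p))))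
... | false = filterᵇ-downFrom-cong p (λ x l → e x (<-trans l (n<1+n p)))

filterᵇ-downFrom-none : ∀ p {f : ℕ → Bool} → (∀ x → x < p → f x ≡ false) → filterᵇ f (downFrom p) ≡ []
filterᵇ-downFrom-none zero e = refl
filterᵇ-downFrom-none (suc p) e rewrite e p (n<1+n p) = filterᵇ-downFrom-none p (λ x l → e x (<-trans l (n<1+n p)))

elem-filterᵇ-downFrom : ∀ p x {f : ℕ → Bool} → x < p → f x ≡ true → elem x (filterᵇ f (downFrom p)) ≡ true
elem-filterᵇ-downFrom (suc p) x {f} l fx with m≤n⇒m<n∨m≡n (≤-pred l)
... | inj₂ refl rewrite fx | ≡ᵇ-refl x = refl
... | inj₁ x<p with f p
... | true rewrite ≡ᵇ-false {x} {p} (<⇒≢ x<p) = elem-filterᵇ-downFrom p x x<p fx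
... | false = elem-filterᵇ-downFrom p x x<p fx

remove-filterᵇ-downFrom : ∀ p c {f : ℕ → Bool} → c < p → f c ≡ true →
  remove c (filterᵇ f (downFrom p)) ≡ filterᵇ (λ x → f x ∧ not (x ≡ᵇ c)) (downFrom p)
remove-filterᵇ-downFrom (suc p) c {f} l fc with m≤n⇒m<n∨m≡n (≤-pred l)
... | inj₂ refl rewrite fc | ≡ᵇ-refl c =
  filterᵇ-downFrom-cong c (λ x x<c → sym (trans (cong (λ z → f x ∧ not z) (≡ᵇ-false (<⇒≢ x<c))) (∧-identityʳ (f x))))
... | inj₁ c<p rewrite ≡ᵇ-false {p} {c} (λ e → <-irrefl (sym e) c<p) with f p
... | true rewrite ≡ᵇ-false {c} {p} (<⇒≢ c<p) = cong (p ∷_) (remove-filterᵇ-downFrom p c c<p fc)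
... | false = remove-filterᵇ-downFrom p c c<p fc

≤ᵇ-suc-≢ : ∀ p y → y ≢ p → (p ≤ᵇ y) ≡ (suc p ≤ᵇ y)
≤ᵇ-suc-≢ p y y≢p with <-cmp p y
... | tri< p<y _ _ = trans (≤ᵇ-true (<⇒≤ p<y)) (sym (≤ᵇ-true p<y))
... | tri≈ _ p≡y _ = ⊥-elim (y≢p (sym p≡y))
... | tri> _ _ y<p = trans (≤ᵇ-false y<p) (sym (≤ᵇ-false (<-trans y<p (n<1+n p))))

module InvolutionCompletes (L : List ℕ) (n : ℕ) (length≡n : length L ≡ n)
    (σ<n : ∀ i → i < n → nth L i < n)
    (σ-no-fixed-point : ∀ i → i < n → nth L i ≢ i)
    (σσ≡id : ∀ i → i < n → nth L (nth L i) ≡ i) where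

  σ : ℕ → ℕ
  σ = nth L

  openAt : ℕ → List ℕ
  openAt p = filterᵇ (λ x → p ≤ᵇ σ x) (downFrom p)

  -- the arc (σ p, p) closes at p
  openAt-close : ∀ p → p < n → σ p < p →
    elem (σ p) (openAt p) ≡ true × remove (σ p) (openAt p) ≡ openAt (suc p)
  openAt-close p p<n a<p =
    elem-filterᵇ-downFrom p a a<p p≤σa ,
    trans (remove-filterᵇ-downFrom p a a<p p≤σa) (trans (filterᵇ-downFrom-cong p still-open) (sym openAt-suc))
    where
      a : ℕ
      a = σ p
      σa≡p : σ a ≡ p
      σa≡p = σσ≡id p p<n
      p≤σa : (p ≤ᵇ σ a) ≡ true
      p≤σa = subst (λ z → (p ≤ᵇ z) ≡ true) (sym σa≡p) (≤ᵇ-true {p} ≤-refl)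
      openAt-suc : openAt (suc p) ≡ filterᵇ (λ x → suc p ≤ᵇ σ x) (downFrom p)
      openAt-suc rewrite ≤ᵇ-false {suc p} {a} (s≤s (<⇒≤ a<p)) = refl
      still-open : ∀ x → x < p → ((p ≤ᵇ σ x) ∧ not (x ≡ᵇ a)) ≡ (suc p ≤ᵇ σ x)
      still-open x x<p with x ≡ᵇ a in x≡a
      ... | true = trans (∧-zeroʳ (p ≤ᵇ σ x))
                     (sym (trans (cong (suc p ≤ᵇ_) (trans (cong σ (≡ᵇ-true⁻¹ x≡a)) σa≡p)) (≤ᵇ-false {suc p} ≤-refl)))
      ... | false = trans (∧-identityʳ (p ≤ᵇ σ x)) (≤ᵇ-suc-≢ p (σ x) (λ σx≡p → ≡ᵇ-false⁻¹ x≡a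
                      (trans (sym (σσ≡id x (<-trans x<p p<n))) (cong σ σx≡p))))

  -- the arc (p, σ p) opens at p
  openAt-open : ∀ p → p < n → p < σ p → openAt (suc p) ≡ p ∷ openAt p
  openAt-open p p<n p<a rewrite ≤ᵇ-true {suc p} {σ p} p<a = cong (p ∷_) (filterᵇ-downFrom-cong p not-σ⁻¹p)
    where
      not-σ⁻¹p : ∀ x → x < p → (suc p ≤ᵇ σ x) ≡ (p ≤ᵇ σ x)
      not-σ⁻¹p x x<p = sym (≤ᵇ-suc-≢ p (σ x) (λ σx≡p → <-irrefl refl
        (<-trans (subst (_< p) (trans (sym (σσ≡id x (<-trans x<p p<n))) (cong σ σx≡p)) x<p) p<a)))

  completes-from : ∀ q p → p + q ≡ n → completes p (openAt p) (drop p L) ≡ true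
  completes-from zero p e rewrite trans (sym (+-identityʳ p)) e | subst (λ k → drop k L ≡ []) length≡n (drop-length L) =
    cong null (filterᵇ-downFrom-none n (λ x l → ≤ᵇ-false (σ<n x l)))
  completes-from (suc q) p e rewrite drop-nth p L (subst (p <_) (sym length≡n) (subst (p <_) e (m<m+n p (s≤s z≤n)))) = step (<-cmp (σ p) p)
    where
      p<n : p < n
      p<n = subst (p <_) e (m<m+n p (s≤s z≤n))
      rest : completes (suc p) (openAt (suc p)) (drop (suc p) L) ≡ true
      rest = completes-from q (suc p) (trans (sym (+-suc p q)) e)
      step : Tri (σ p < p) (σ p ≡ p) (p < σ p) → completes p (openAt p) (σ p ∷ drop (suc p) L) ≡ true
      step (tri< a<p _ _) rewrite <ᵇ-true a<p =
        cong₂ _∧_ (proj₁ (openAt-close p p<n a<p))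
                  (trans (cong (λ X → completes (suc p) X (drop (suc p) L)) (proj₂ (openAt-close p p<n a<p))) rest)
      step (tri≈ _ a≡p _) = ⊥-elim (σ-no-fixed-point p p<n a≡p)
      step (tri> _ a≢p p<a) rewrite <ᵇ-false {σ p} {p} (<⇒≤ p<a) | ≡ᵇ-false {σ p} {p} a≢p =
        cong₂ _∧_ (trans (cong (λ X → completes (suc p) X (drop (suc p) L)) (sym (openAt-open p p<n p<a))) rest)
          (nth⇒hasAt (drop (suc p) L) (σ p ∸ suc p) p
             (subst (σ p ∸ suc p <_) (sym (trans (length-drop (suc p) L) (cong (_∸ suc p) length≡n))) (∸-monoˡ-< (σ<n p p<n) p<a))
             (trans (nth-drop (suc p) (σ p ∸ suc p) L) (trans (cong σ (m+[n∸m]≡n p<a)) (σσ≡id p p<n))))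

-- Crossings as closing weights

if-then-0 : ∀ b c → (if b then c else 0) ≡ ι b * c
if-then-0 true c = sym (+-identityʳ c)
if-then-0 false c = refl

ι-∧-implied : ∀ a x → (a ≡ true → x ≡ true) → ι a ≡ ι x * ι a
ι-∧-implied true x h rewrite h refl = refl
ι-∧-implied false x h = sym (*-zeroʳ (ι x))

sumFin-select : ∀ n (u : Fin n) (g : Fin n → ℕ) → sumFin n (λ l → ι (does (u ≟ᶠ l)) * g l) ≡ g u
sumFin-select (suc n) fz g = trans (sumFin-suc n (λ l → ι (does (fz ≟ᶠ l)) * g l))
   (trans (cong₂ _+_ (+-identityʳ (g fz)) (sumFin-zero n)) (+-identityʳ (g fz)))
sumFin-select (suc n) (fs u) g = trans (sumFin-suc n (λ l → ι (does (fs u ≟ᶠ l)) * g l)) (sumFin-select n u (g ∘ fs))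

countᵇ-values : ∀ {n m} (P : ℕ → Bool) (w : Vec (Fin n) m) → countᵇ P (values w) ≡ sumFin m (λ l → ι (P (toℕ (lookup w l))))
countᵇ-values P [] = refl
countᵇ-values {m = suc m} P (b ∷ w) =
  trans (cong (ι (P (toℕ b)) +_) (countᵇ-values P w)) (sym (sumFin-suc m (λ l → ι (P (toℕ (lookup (b ∷ w) l))))))

module _ {n : ℕ} where
  -- the value at index i of v sits at position p + i
  closingTerm : ∀ {k} → ℕ → Vec (Fin n) k → Fin k → Fin k → ℕ
  closingTerm p v i l = ι ((toℕ i <ᵇ toℕ l) ∧ ((toℕ (lookup v l) <ᵇ p + toℕ i) ∧ (toℕ (lookup v i) <ᵇ toℕ (lookup v l))))

  closingWeight-sumFin : ∀ {k} p (v : Vec (Fin n) k) → closingWeight p (values v) ≡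
    sumFin k (λ i → ι (toℕ (lookup v i) <ᵇ p + toℕ i) * sumFin k (closingTerm p v i))
  closingWeight-sumFin p [] = refl
  closingWeight-sumFin {suc k} p (a ∷ v) = sym (begin
    sumFin (suc k) (λ i → ι (toℕ (lookup (a ∷ v) i) <ᵇ p + toℕ i) * sumFin (suc k) (closingTerm p (a ∷ v) i))
      ≡⟨ sumFin-suc k _ ⟩
    ι (toℕ a <ᵇ p + 0) * sumFin (suc k) (closingTerm p (a ∷ v) fz)
      + sumFin k (λ i → ι (toℕ (lookup v i) <ᵇ p + suc (toℕ i)) * sumFin (suc k) (closingTerm p (a ∷ v) (fs i)))
      ≡⟨ cong₂ _+_ first (sumFin-cong k shifted) ⟩
    closeAt-a + sumFin k (λ i → ι (toℕ (lookup v i) <ᵇ suc p + toℕ i) * sumFin k (closingTerm (suc p) v i))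
      ≡⟨ cong (closeAt-a +_) (closingWeight-sumFin (suc p) v) ⟨
    closingWeight p (values (a ∷ v)) ∎)
    where
      open ≡-Reasoning
      closeAt-a : ℕ
      closeAt-a = if toℕ a <ᵇ p then countᵇ (λ y → (y <ᵇ p) ∧ (toℕ a <ᵇ y)) (values v) else 0
      first : ι (toℕ a <ᵇ p + 0) * sumFin (suc k) (closingTerm p (a ∷ v) fz) ≡ closeAt-a
      first rewrite +-identityʳ p =
        trans (cong (ι (toℕ a <ᵇ p) *_)
                    (trans (sumFin-suc k (λ l → ι ((0 <ᵇ toℕ l) ∧ ((toℕ (lookup (a ∷ v) l) <ᵇ p)
                                                                    ∧ (toℕ a <ᵇ toℕ (lookup (a ∷ v) l))))))
                           (sym (countᵇ-values (λ y → (y <ᵇ p) ∧ (toℕ a <ᵇ y)) v))))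
              (sym (if-then-0 (toℕ a <ᵇ p) _))
      shifted : ∀ i → ι (toℕ (lookup v i) <ᵇ p + suc (toℕ i)) * sumFin (suc k) (closingTerm p (a ∷ v) (fs i))
                      ≡ ι (toℕ (lookup v i) <ᵇ suc p + toℕ i) * sumFin k (closingTerm (suc p) v i)
      shifted i rewrite +-suc p (toℕ i) =
        cong (ι (toℕ (lookup v i) <ᵇ suc p + toℕ i) *_)
          (sumFin-suc k (λ l → ι ((suc (toℕ i) <ᵇ toℕ l) ∧ ((toℕ (lookup (a ∷ v) l) <ᵇ suc p + toℕ i)
                                                             ∧ (toℕ (lookup v i) <ᵇ toℕ (lookup (a ∷ v) l))))))

ι-∧-closing : ∀ a b c x → ((a ∧ b) ≡ true → x ≡ true) → ι a * ι (b ∧ c) ≡ ι x * ι (c ∧ (b ∧ a))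
ι-∧-closing a b c x h rewrite ι-∧ b c | ι-∧ c (b ∧ a) | ι-∧ b a = begin
  ι a * (ι b * ι c)           ≡⟨ *-assoc (ι a) (ι b) (ι c) ⟨
  ι a * ι b * ι c             ≡⟨ cong (_* ι c) ab≡xab ⟩
  ι x * (ι a * ι b) * ι c     ≡⟨ rearrange (ι x) (ι a) (ι b) (ι c) ⟩
  ι x * (ι c * (ι b * ι a))   ∎
  where
    open ≡-Reasoning
    ab≡xab : ι a * ι b ≡ ι x * (ι a * ι b)
    ab≡xab = trans (sym (ι-∧ a b)) (trans (ι-∧-implied (a ∧ b) x h) (cong (ι x *_) (ι-∧ a b)))
    rearrange : ∀ x a b c → x * (a * b) * c ≡ x * (c * (b * a))
    rearrange = solve-∀

indicator≡ι : ∀ {P : Set} (d : Dec P) → indicator d ≡ ι (does d)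
indicator≡ι (yes _) = refl
indicator≡ι (no _) = refl

ι-∧-rearrange₅ : ∀ a b c d e → ι (a ∧ (b ∧ (c ∧ (d ∧ e)))) ≡ ι (a ∧ (b ∧ d)) * (ι e * ι c)
ι-∧-rearrange₅ a b c d e
  rewrite ι-∧ a (b ∧ (c ∧ (d ∧ e))) | ι-∧ b (c ∧ (d ∧ e)) | ι-∧ c (d ∧ e) | ι-∧ d e | ι-∧ a (b ∧ d) | ι-∧ b d
  = rearrange (ι a) (ι b) (ι c) (ι d) (ι e)
  where rearrange : ∀ a b c d e → a * (b * (c * (d * e))) ≡ (a * (b * d)) * (e * c)
        rearrange = solve-∀

ι-∧-rearrange₄ : ∀ a b c d → ι (a ∧ (b ∧ d)) * ι c ≡ ι a * (ι d * ι (b ∧ c))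
ι-∧-rearrange₄ a b c d rewrite ι-∧ a (b ∧ d) | ι-∧ b d | ι-∧ b c = rearrange (ι a) (ι b) (ι c) (ι d)
  where rearrange : ∀ a b c d → a * (b * d) * c ≡ a * (d * (b * c))
        rearrange = solve-∀

module CrossingsOfInvolution {n} (σ : Vec (Fin n) n) (σσ≡id : ∀ i → lookup σ (lookup σ i) ≡ i) where
  s : Fin n → Fin n
  s = lookup σ

  infix 4 _≺_ _≟ᵇ_
  _≺_ : Fin n → Fin n → Bool
  x ≺ y = toℕ x <ᵇ toℕ y

  _≟ᵇ_ : Fin n → Fin n → Bool
  x ≟ᵇ y = does (x ≟ᶠ y)

  s-≟ᵇ : ∀ J i → (s J ≟ᵇ i) ≡ (s i ≟ᵇ J)
  s-≟ᵇ J i with s J ≟ᶠ i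
  ... | yes e = sym (dec-true (s i ≟ᶠ J) (trans (cong s (sym e)) (σσ≡id J)))
  ... | no ne = sym (dec-false (s i ≟ᶠ J) (λ e → ne (trans (cong s (sym e)) (σσ≡id i))))

  sumFin-reindex : ∀ h → sumFin n h ≡ sumFin n (h ∘ s)
  sumFin-reindex h = sym (begin
    sumFin n (h ∘ s)                                               ≡⟨ sumFin-cong n (λ J → sumFin-select n (s J) h) ⟨
    sumFin n (λ J → sumFin n (λ i → ι (s J ≟ᵇ i) * h i))           ≡⟨ sumFin-swap n n (λ J i → ι (s J ≟ᵇ i) * h i) ⟩
    sumFin n (λ i → sumFin n (λ J → ι (s J ≟ᵇ i) * h i))
      ≡⟨ sumFin-cong n (λ i → sumFin-cong n (λ J → cong (λ z → ι z * h i) (s-≟ᵇ J i))) ⟩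
    sumFin n (λ i → sumFin n (λ J → ι (s i ≟ᵇ J) * h i))           ≡⟨ sumFin-cong n (λ i → sumFin-select n (s i) (λ _ → h i)) ⟩
    sumFin n h ∎)
    where open ≡-Reasoning

  crossingPair : Fin n → Fin n → ℕ
  crossingPair i k = ι (i ≺ k) * ι ((k ≺ s i) ∧ (s i ≺ s k))

  sum-over-l : ∀ i j k → sumFin n (λ l → indicator (crossing? σ i j k l))
                          ≡ ι ((i ≺ k) ∧ ((k ≺ j) ∧ (s i ≟ᵇ j))) * ι (j ≺ s k)
  sum-over-l i j k = begin
    sumFin n (λ l → indicator (crossing? σ i j k l))
      ≡⟨ sumFin-cong n (λ l → trans (indicator≡ι (crossing? σ i j k l))
                                     (ι-∧-rearrange₅ (i ≺ k) (k ≺ j) (j ≺ l) (s i ≟ᵇ j) (s k ≟ᵇ l))) ⟩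
    sumFin n (λ l → c * (ι (s k ≟ᵇ l) * ι (j ≺ l)))
      ≡⟨ sumFin-* n c (λ l → ι (s k ≟ᵇ l) * ι (j ≺ l)) ⟩
    c * sumFin n (λ l → ι (s k ≟ᵇ l) * ι (j ≺ l))
      ≡⟨ cong (c *_) (sumFin-select n (s k) (λ l → ι (j ≺ l))) ⟩
    c * ι (j ≺ s k) ∎
    where
      open ≡-Reasoning
      c : ℕ
      c = ι ((i ≺ k) ∧ ((k ≺ j) ∧ (s i ≟ᵇ j)))

  sum-over-j : ∀ i k → sumFin n (λ j → ι ((i ≺ k) ∧ ((k ≺ j) ∧ (s i ≟ᵇ j))) * ι (j ≺ s k)) ≡ crossingPair i k
  sum-over-j i k = begin
    sumFin n (λ j → ι ((i ≺ k) ∧ ((k ≺ j) ∧ (s i ≟ᵇ j))) * ι (j ≺ s k))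
      ≡⟨ sumFin-cong n (λ j → ι-∧-rearrange₄ (i ≺ k) (k ≺ j) (j ≺ s k) (s i ≟ᵇ j)) ⟩
    sumFin n (λ j → ι (i ≺ k) * (ι (s i ≟ᵇ j) * ι ((k ≺ j) ∧ (j ≺ s k))))
      ≡⟨ sumFin-* n (ι (i ≺ k)) (λ j → ι (s i ≟ᵇ j) * ι ((k ≺ j) ∧ (j ≺ s k))) ⟩
    ι (i ≺ k) * sumFin n (λ j → ι (s i ≟ᵇ j) * ι ((k ≺ j) ∧ (j ≺ s k)))
      ≡⟨ cong (ι (i ≺ k) *_) (sumFin-select n (s i) (λ j → ι ((k ≺ j) ∧ (j ≺ s k)))) ⟩
    crossingPair i k ∎
    where open ≡-Reasoning

  crossings≡sum-crossingPair : crossings σ ≡ sumFin n (λ i → sumFin n (crossingPair i))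
  crossings≡sum-crossingPair = sumFin-cong n (λ i →
    trans (sumFin-cong n (λ j → sumFin-cong n (sum-over-l i j)))
    (trans (sumFin-swap n n (λ j k → ι ((i ≺ k) ∧ ((k ≺ j) ∧ (s i ≟ᵇ j))) * ι (j ≺ s k)))
           (sumFin-cong n (sum-over-j i))))

  -- with J = s i and l = s k, the arc (s J, J) closes at J and crosses (l, s l)
  crossingPair-reindexed : ∀ J l → crossingPair (s J) (s l) ≡ ι (s J ≺ J) * closingTerm 0 σ J l
  crossingPair-reindexed J l rewrite σσ≡id J | σσ≡id l =
    ι-∧-closing (s J ≺ s l) (s l ≺ J) (J ≺ l) (s J ≺ J) closes-before
    where
      closes-before : ((s J ≺ s l) ∧ (s l ≺ J)) ≡ true → (s J ≺ J) ≡ true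
      closes-before e with ∧-true⁻¹ e
      ... | e₁ , e₂ = <ᵇ-true {toℕ (s J)} {toℕ J} (<-trans (<ᵇ-true⁻¹ {toℕ (s J)} e₁) (<ᵇ-true⁻¹ {toℕ (s l)} e₂))

  crossings≡closingWeight : crossings σ ≡ closingWeight 0 (values σ)
  crossings≡closingWeight = begin
    crossings σ
      ≡⟨ crossings≡sum-crossingPair ⟩
    sumFin n (λ i → sumFin n (crossingPair i))
      ≡⟨ sumFin-reindex (λ i → sumFin n (crossingPair i)) ⟩
    sumFin n (λ J → sumFin n (crossingPair (s J)))
      ≡⟨ sumFin-cong n (λ J → sumFin-reindex (crossingPair (s J))) ⟩
    sumFin n (λ J → sumFin n (λ l → crossingPair (s J) (s l)))
      ≡⟨ sumFin-cong n (λ J → sumFin-cong n (crossingPair-reindexed J)) ⟩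
    sumFin n (λ J → sumFin n (λ l → ι (s J ≺ J) * closingTerm 0 σ J l))
      ≡⟨ sumFin-cong n (λ J → sumFin-* n (ι (s J ≺ J)) (closingTerm 0 σ J)) ⟩
    sumFin n (λ J → ι (s J ≺ J) * sumFin n (closingTerm 0 σ J))
      ≡⟨ closingWeight-sumFin 0 σ ⟨
    closingWeight 0 (values σ) ∎
    where open ≡-Reasoning

-- The left-hand side as a walk count

nth-values : ∀ {n k} (σ : Vec (Fin n) k) (i : Fin k) → nth (values σ) (toℕ i) ≡ toℕ (lookup σ i)
nth-values (a ∷ σ) fz = refl
nth-values (a ∷ σ) (fs i) = nth-values σ i

if-does≈if : ∀ {P : Set} (d : Dec P) (b : Bool) (x y : Poly) → (P → (b ≡ true) × (x ≡ y)) → (b ≡ true → P) →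
             (if does d then x else []) ≈ (if b then y else [])
if-does≈if (yes p) b x y f g rewrite proj₁ (f p) | proj₂ (f p) = ≈-refl
if-does≈if (no ¬p) true x y f g = ⊥-elim (¬p (g refl))
if-does≈if (no ¬p) false x y f g = ≈-refl

module _ {n : ℕ} (σ : Vec (Fin n) n) where
  private
    L : List ℕ
    L = values σ

    nth-values-fromℕ< : ∀ i (l : i < n) → nth L i ≡ toℕ (lookup σ (fromℕ< l))
    nth-values-fromℕ< i l = trans (cong (nth L) (sym (toℕ-fromℕ< l))) (nth-values σ (fromℕ< l))

    index< : ∀ i → toℕ i < length L
    index< i = subst (toℕ i <_) (sym (length-values σ)) (toℕ<n i)

  IsFPFInvolution⇒completes : IsFPFInvolution σ → completes 0 [] L ≡ true
  IsFPFInvolution⇒completes (σσ≡id , no-fixed-point) =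
    InvolutionCompletes.completes-from L n (length-values σ) bound no-fixed-point' involutive n 0 refl
    where
      bound : ∀ i → i < n → nth L i < n
      bound i l rewrite nth-values-fromℕ< i l = toℕ<n _
      no-fixed-point' : ∀ i → i < n → nth L i ≢ i
      no-fixed-point' i l e = no-fixed-point (fromℕ< l)
        (toℕ-injective (trans (sym (nth-values-fromℕ< i l)) (trans e (sym (toℕ-fromℕ< l)))))
      involutive : ∀ i → i < n → nth L (nth L i) ≡ i
      involutive i l = begin
        nth L (nth L i)                         ≡⟨ cong (nth L) (nth-values-fromℕ< i l) ⟩
        nth L (toℕ (lookup σ (fromℕ< l)))       ≡⟨ nth-values σ (lookup σ (fromℕ< l)) ⟩
        toℕ (lookup σ (lookup σ (fromℕ< l)))    ≡⟨ cong toℕ (σσ≡id (fromℕ< l)) ⟩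
        toℕ (fromℕ< l)                          ≡⟨ toℕ-fromℕ< l ⟩
        i ∎
        where open ≡-Reasoning

  completes⇒IsFPFInvolution : completes 0 [] L ≡ true → IsFPFInvolution σ
  completes⇒IsFPFInvolution r = σσ≡id , no-fixed-point
    where
      σσ≡id : ∀ i → lookup σ (lookup σ i) ≡ i
      σσ≡id i = toℕ-injective (begin
        toℕ (lookup σ (lookup σ i))   ≡⟨ nth-values σ (lookup σ i) ⟨
        nth L (toℕ (lookup σ i))      ≡⟨ cong (nth L) (nth-values σ i) ⟨
        nth L (nth L (toℕ i))         ≡⟨ proj₂ (completes⇒involutive 0 [] L r [] (toℕ i) (index< i) z≤n) ⟩
        toℕ i ∎)
        where open ≡-Reasoning
      no-fixed-point : ∀ i → lookup σ i ≢ i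
      no-fixed-point i e = completes⇒no-fixed-point 0 [] L r [] (toℕ i) (index< i) (trans (nth-values σ i) (cong toℕ e))

  involution-weight : (if does (isFPFInvolution? σ) then qpow (crossings σ) else []) ≈ Diagrams.weight n 0 [] σ
  involution-weight =
    if-does≈if (isFPFInvolution? σ) (completes 0 [] L) (qpow (crossings σ)) (qpow (closingWeight 0 L))
      (λ inv → IsFPFInvolution⇒completes inv , cong qpow (CrossingsOfInvolution.crossings≡closingWeight σ (proj₁ inv)))
      completes⇒IsFPFInvolution

T≈walks : ∀ m → T m ≈ walks (2 * m) 0
T≈walks m = begin
  T m
    ≈⟨ sumP-filter isFPFInvolution? (λ σ → qpow (crossings σ)) (allVecs n n) ⟩
  sumP (λ σ → if does (isFPFInvolution? σ) then qpow (crossings σ) else []) (allVecs n n)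
    ≈⟨ sumP-cong involution-weight (allVecs n n) ⟩
  Diagrams.completionSum n n 0 []
    ≈⟨ Diagrams.completionSum≈walks n n 0 [] tt [] ≤-refl ⟩
  walks n 0 ∎
  where
    open ≈-Reasoning
    n : ℕ
    n = 2 * m

-- The right-hand side as a walk count

-- rCount v x = #{ i : v_i ≤ x + i } (0-based), so r c (j + 1) = rCount (values c) j.
rCount : List ℕ → ℕ → ℕ
rCount [] x = 0
rCount (a ∷ v) x = ι (a ≤ᵇ x) + rCount v (suc x)

-- ∏_{j=J}^{J+f−1} [r_{j+1} − j]_q for a sequence c whose first t entries are
-- already consumed (all of them counted in r) and whose remaining entries are v.
rProduct : ℕ → ℕ → ℕ → List ℕ → Poly
rProduct t J zero v = oneP
rProduct t J (suc f) v = qint ((t + rCount v (J + t)) ∸ J) ⊗ rProduct t (suc J) f v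

increasing : List ℕ → Bool
increasing [] = true
increasing (a ∷ v) = all (a <ᵇ_) v ∧ increasing v

all-weaken : ∀ {f g : ℕ → Bool} → (∀ y → f y ≡ true → g y ≡ true) → ∀ w → all f w ≡ true → all g w ≡ true
all-weaken h [] e = refl
all-weaken {f} h (x ∷ w) e with ∧-true⁻¹ {f x} e
... | e₁ , e₂ rewrite h x e₁ = all-weaken h w e₂

rProduct-entry : ∀ f t J₀ J w → J₀ ≤ J → rProduct t J f ((t + J₀) ∷ w) ≡ rProduct (suc t) J f w
rProduct-entry zero t J₀ J w le = refl
rProduct-entry (suc f) t J₀ J w le =
  cong₂ _⊗_ (cong qint (cong (_∸ J) counted)) (rProduct-entry f t J₀ (suc J) w (≤-trans le (n≤1+n J)))
  where
    counted : t + rCount ((t + J₀) ∷ w) (J + t) ≡ suc t + rCount w (J + suc t)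
    counted rewrite ≤ᵇ-true {t + J₀} {J + t} (subst (t + J₀ ≤_) (+-comm t J) (+-monoʳ-≤ t le)) | +-suc J t = +-suc t _

rCount-above : ∀ a w x → increasing (a ∷ w) ≡ true → x < a → rCount (a ∷ w) x ≡ 0
rCount-above a [] x i x<a rewrite ≤ᵇ-false {a} {x} x<a = refl
rCount-above a (b ∷ w) x i x<a with ∧-true⁻¹ {all (a <ᵇ_) (b ∷ w)} i
... | a<w , inc rewrite ≤ᵇ-false {a} {x} x<a =
  rCount-above b w (suc x) inc (<-≤-trans (s≤s x<a) (<ᵇ-true⁻¹ (proj₁ (∧-true⁻¹ {a <ᵇ b} a<w))))

rProduct-factor : ∀ f t J a w → increasing (a ∷ w) ≡ true → J + t < a →
                  rProduct t J (suc f) (a ∷ w) ≡ (qint (t ∸ J) ⊗ rProduct t (suc J) f (a ∷ w))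
rProduct-factor f t J a w i lt rewrite rCount-above a w (J + t) i lt | +-identityʳ t = refl

length-filter≡countᵇ : ∀ {A : Set} {ℓ} {P : A → Set ℓ} (P? : ∀ x → Dec (P x)) L →
                       length (filter P? L) ≡ countᵇ (λ x → does (P? x)) L
length-filter≡countᵇ P? [] = refl
length-filter≡countᵇ P? (x ∷ L) with does (P? x)
... | true = cong suc (length-filter≡countᵇ P? L)
... | false = length-filter≡countᵇ P? L

countᵇ-r-shifted : ∀ {N k} j (v : Vec (Fin N) k) →
  countᵇ (λ i → toℕ (lookup v i) + 1 ≤ᵇ suc j + (toℕ i + 1) ∸ 1) (allFin k) ≡ rCount (values v) j
countᵇ-r-shifted j [] = refl
countᵇ-r-shifted {k = suc k} j (a ∷ v) =
  trans (countᵇ-allFin-suc k (λ i → toℕ (lookup (a ∷ v) i) + 1 ≤ᵇ suc j + (toℕ i + 1) ∸ 1))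
    (cong₂ _+_ (cong ι +1≤ᵇ+1)
      (trans (countᵇ-cong (λ i → cong (λ z → toℕ (lookup v i) + 1 ≤ᵇ z ∸ 1) (+-suc (suc j) (toℕ i + 1))) (allFin k))
             (countᵇ-r-shifted (suc j) v)))
  where
    +1≤ᵇ+1 : (toℕ a + 1 ≤ᵇ j + 1) ≡ (toℕ a ≤ᵇ j)
    +1≤ᵇ+1 rewrite +-comm (toℕ a) 1 | +-comm j 1 = <ᵇ-suc (toℕ a) j

r≡rCount : ∀ {N m} (c : Vec (Fin N) m) j → r c (j + 1) ≡ rCount (values c) j
r≡rCount {m = m} c j =
  trans (length-filter≡countᵇ _ (allFin m))
    (trans (countᵇ-cong (λ i → cong (λ z → toℕ (lookup c i) + 1 ≤ᵇ z + (toℕ i + 1) ∸ 1) (+-comm j 1)) (allFin m))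
      (countᵇ-r-shifted j c))

prodP-tabulate : ∀ {A : Set} n (f : A → Poly) (g : Fin n → A) → prodP f (tabulate g) ≡ prodP (f ∘ g) (allFin n)
prodP-tabulate zero f g = refl
prodP-tabulate (suc n) f g = cong (f (g fz) ⊗_) (trans (prodP-tabulate n f (g ∘ fs)) (sym (prodP-tabulate n (f ∘ g) fs)))

prodP-cong : ∀ {A : Set} {f g : A → Poly} → (∀ x → f x ≈ g x) → ∀ L → prodP f L ≈ prodP g L
prodP-cong e [] = ≈-refl
prodP-cong {f = f} {g} e (x ∷ L) = ≈-trans (⊗-congˡ (prodP f L) (e x)) (⊗-congʳ (g x) (prodP-cong e L))

prodP≈rProduct : ∀ f J w → prodP (λ j → qint (rCount w (J + toℕ j) ∸ (J + toℕ j))) (allFin f) ≈ rProduct 0 J f w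
prodP≈rProduct zero J w = ≈-refl
prodP≈rProduct (suc f) J w = begin
  prodP (λ j → factor (J + toℕ j)) (allFin (suc f))
    ≡⟨ cong₂ _⊗_ (cong factor (+-identityʳ J)) (prodP-tabulate f (λ j → factor (J + toℕ j)) fs) ⟩
  factor J ⊗ prodP (λ j → factor (J + suc (toℕ j))) (allFin f)
    ≈⟨ ⊗-congʳ (factor J) (prodP-cong (λ j → ≡⇒≈ (cong factor (+-suc J (toℕ j)))) (allFin f)) ⟩
  factor J ⊗ prodP (λ j → factor (suc J + toℕ j)) (allFin f)
    ≈⟨ ⊗-congʳ (factor J) (prodP≈rProduct f (suc J) w) ⟩
  factor J ⊗ rProduct 0 (suc J) f w
    ≡⟨ cong (λ z → qint (rCount w z ∸ J) ⊗ rProduct 0 (suc J) f w) (sym (+-identityʳ J)) ⟩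
  rProduct 0 J (suc f) w ∎
  where
    open ≈-Reasoning
    factor : ℕ → Poly
    factor x = qint (rCount w x ∸ x)

term≈rProduct : ∀ {N m} (c : Vec (Fin N) m) → term c ≈ rProduct 0 0 m (values c)
term≈rProduct {m = m} c =
  ≈-trans (prodP-cong (λ j → ≡⇒≈ (cong (λ z → qint (z ∸ toℕ j)) (r≡rCount c (toℕ j)))) (allFin m))
          (prodP≈rProduct m 0 (values c))

all-values-intro : ∀ {N k} (f : ℕ → Bool) (v : Vec (Fin N) k) → (∀ i → f (toℕ (lookup v i)) ≡ true) → all f (values v) ≡ true
all-values-intro f [] h = refl
all-values-intro f (a ∷ v) h rewrite h fz = all-values-intro f v (h ∘ fs)

all-values-elim : ∀ {N k} (f : ℕ → Bool) (v : Vec (Fin N) k) → all f (values v) ≡ true → ∀ i → f (toℕ (lookup v i)) ≡ true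
all-values-elim f (a ∷ v) e fz = proj₁ (∧-true⁻¹ e)
all-values-elim f (a ∷ v) e (fs i) = all-values-elim f v (proj₂ (∧-true⁻¹ {f (toℕ a)} e)) i

StrictlyIncreasing⇒increasing : ∀ {N k} (c : Vec (Fin N) k) → StrictlyIncreasing c → increasing (values c) ≡ true
StrictlyIncreasing⇒increasing [] inc = refl
StrictlyIncreasing⇒increasing (a ∷ c) inc rewrite all-values-intro (toℕ a <ᵇ_) c (λ i → <ᵇ-true (inc fz (fs i) (s≤s z≤n))) =
  StrictlyIncreasing⇒increasing c (λ x y l → inc (fs x) (fs y) (s≤s l))

increasing⇒StrictlyIncreasing : ∀ {N k} (c : Vec (Fin N) k) → increasing (values c) ≡ true → StrictlyIncreasing c
increasing⇒StrictlyIncreasing (a ∷ c) e fz (fs y) l = <ᵇ-true⁻¹ (all-values-elim (toℕ a <ᵇ_) c (proj₁ (∧-true⁻¹ e)) y)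
increasing⇒StrictlyIncreasing (a ∷ c) e (fs x) (fs y) (s≤s l) =
  increasing⇒StrictlyIncreasing c (proj₂ (∧-true⁻¹ {all (toℕ a <ᵇ_) (values c)} e)) x y l

does≡ : ∀ {P : Set} (d : Dec P) (b : Bool) → (P → b ≡ true) → (b ≡ true → P) → does d ≡ b
does≡ (yes p) b f g = sym (f p)
does≡ (no ¬p) true f g = ⊥-elim (¬p (g refl))
does≡ (no ¬p) false f g = refl

does-strictlyIncreasing? : ∀ {N k} (c : Vec (Fin N) k) → does (strictlyIncreasing? c) ≡ increasing (values c)
does-strictlyIncreasing? c =
  does≡ (strictlyIncreasing? c) (increasing (values c)) (StrictlyIncreasing⇒increasing c) (increasing⇒StrictlyIncreasing c)

all-0≤ᵇ : ∀ w → all (0 ≤ᵇ_) w ≡ true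
all-0≤ᵇ [] = refl
all-0≤ᵇ (x ∷ w) = all-0≤ᵇ w

-- Scanning position t + J, after t entries of c and J factors of the product.
module IncreasingSums (M N : ℕ) where

  partialTerm : ℕ → ℕ → ∀ {L} → Vec (Fin N) L → Poly
  partialTerm t J c =
    if increasing (values c) ∧ all (t + J ≤ᵇ_) (values c) then rProduct t J (M ∸ J) (values c) else []

  partialSum : ℕ → ℕ → ℕ → Poly
  partialSum L t J = sumP (partialTerm t J) (allVecs L N)

  module NextPosition (t J : ℕ) (J<M : J < M) where
    p : ℕ
    p = t + J

    -- the next entry of c is p: an up step
    partialTerm-entry : ∀ X I Y (w : List ℕ) → (X ≡ true → Y ≡ true) →
      (if (X ∧ I) ∧ (true ∧ Y) then rProduct t J (M ∸ J) (p ∷ w) else [])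
      ≈ ((if I ∧ X then rProduct (suc t) J (M ∸ J) w else []) ⊕ (qint (t ∸ J) ⊗ []))
    partialTerm-entry true true Y w h rewrite h refl | rProduct-entry (M ∸ J) t J J w ≤-refl =
      ≈-sym (≈-trans (⊕-congʳ _ (⊗-zeroʳ (qint (t ∸ J)))) (⊕-identityʳ _))
    partialTerm-entry true false Y w h = ≈-sym (⊗-zeroʳ (qint (t ∸ J)))
    partialTerm-entry false true Y w h = ≈-sym (⊗-zeroʳ (qint (t ∸ J)))
    partialTerm-entry false false Y w h = ≈-sym (⊗-zeroʳ (qint (t ∸ J)))

    -- all remaining entries exceed p, so p yields the factor [t − J]: a down step
    partialTerm-factor : ∀ a X I Y Y' (w : List ℕ) → p < a → (X ≡ true → Y ≡ true) → (X ≡ true → Y' ≡ true) →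
      (X ∧ I) ≡ increasing (a ∷ w) →
      (if (X ∧ I) ∧ (true ∧ Y) then rProduct t J (M ∸ J) (a ∷ w) else [])
      ≈ ([] ⊕ (qint (t ∸ J) ⊗ (if (X ∧ I) ∧ (true ∧ Y') then rProduct t (suc J) (M ∸ suc J) (a ∷ w) else [])))
    partialTerm-factor a true true Y Y' w p<a h h' inc rewrite h refl | h' refl | +-∸-assoc 1 J<M =
      ≡⇒≈ (rProduct-factor (M ∸ suc J) t J a w (sym inc) (subst (_< a) (+-comm t J) p<a))
    partialTerm-factor a true false Y Y' w p<a h h' inc = ≈-sym (⊗-zeroʳ (qint (t ∸ J)))
    partialTerm-factor a false I Y Y' w p<a h h' inc = ≈-sym (⊗-zeroʳ (qint (t ∸ J)))

    p<t+sucJ : p < t + suc J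
    p<t+sucJ = subst (p <_) (sym (+-suc t J)) (n<1+n p)

    partialTerm-∷ : ∀ {L} (a : Fin N) (v : Vec (Fin N) L) →
      partialTerm t J (a ∷ v)
      ≈ ((if toℕ a ≡ᵇ p then partialTerm (suc t) J v else []) ⊕ (qint (t ∸ J) ⊗ partialTerm t (suc J) (a ∷ v)))
    partialTerm-∷ a v with <-cmp (toℕ a) p
    ... | tri< a<p _ _ rewrite ≤ᵇ-false {p} {toℕ a} a<p | ≡ᵇ-false {toℕ a} {p} (<⇒≢ a<p)
                             | ≤ᵇ-false {t + suc J} {toℕ a} (<-trans a<p p<t+sucJ)
                             | ∧-zeroʳ (all (toℕ a <ᵇ_) (values v) ∧ increasing (values v)) =
      ≈-sym (⊗-zeroʳ (qint (t ∸ J)))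
    ... | tri≈ _ a≡p _ rewrite a≡p | ≡ᵇ-refl p | ≤ᵇ-true {p} {p} ≤-refl | ≤ᵇ-false {t + suc J} {p} p<t+sucJ
                             | ∧-zeroʳ (all (p <ᵇ_) (values v) ∧ increasing (values v)) =
      partialTerm-entry (all (p <ᵇ_) (values v)) (increasing (values v)) (all (p ≤ᵇ_) (values v)) (values v)
        (all-weaken (λ y e → ≤ᵇ-true (<⇒≤ (<ᵇ-true⁻¹ {p} {y} e))) (values v))
    ... | tri> _ _ p<a rewrite ≤ᵇ-true {p} {toℕ a} (<⇒≤ p<a) | ≡ᵇ-false {toℕ a} {p} (λ e → <-irrefl (sym e) p<a)
                             | ≤ᵇ-true {t + suc J} {toℕ a} (subst (_≤ toℕ a) (sym (+-suc t J)) p<a) =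
      partialTerm-factor (toℕ a) (all (toℕ a <ᵇ_) (values v)) (increasing (values v)) (all (p ≤ᵇ_) (values v))
        (all (t + suc J ≤ᵇ_) (values v)) (values v) p<a
        (all-weaken (λ y e → ≤ᵇ-true (≤-trans (<⇒≤ p<a) (<⇒≤ (<ᵇ-true⁻¹ {toℕ a} {y} e)))) (values v))
        (all-weaken (λ y e → ≤ᵇ-true (subst (_≤ y) (sym (+-suc t J)) (<-trans p<a (<ᵇ-true⁻¹ {toℕ a} {y} e)))) (values v))
        refl

  partialSum-suc : ∀ L t J → J < M → t + J < N →
    partialSum (suc L) t J ≈ (partialSum L (suc t) J ⊕ (qint (t ∸ J) ⊗ partialSum (suc L) t (suc J)))
  partialSum-suc L t J J<M p<N = begin
    partialSum (suc L) t J
      ≈⟨ sumP-cong (λ { (a ∷ v) → NextPosition.partialTerm-∷ t J J<M a v }) (allVecs (suc L) N) ⟩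
    sumP (λ c → entryTerm c ⊕ (qint (t ∸ J) ⊗ partialTerm t (suc J) c)) (allVecs (suc L) N)
      ≈⟨ sumP-⊕ entryTerm (λ c → qint (t ∸ J) ⊗ partialTerm t (suc J) c) (allVecs (suc L) N) ⟩
    sumP entryTerm (allVecs (suc L) N) ⊕ sumP (λ c → qint (t ∸ J) ⊗ partialTerm t (suc J) c) (allVecs (suc L) N)
      ≈⟨ ⊕-cong entries (≈-sym (⊗-sumP (qint (t ∸ J)) (partialTerm t (suc J)) (allVecs (suc L) N))) ⟩
    partialSum L (suc t) J ⊕ (qint (t ∸ J) ⊗ partialSum (suc L) t (suc J)) ∎
    where
      open ≈-Reasoning
      entryTerm : Vec (Fin N) (suc L) → Poly
      entryTerm (a ∷ v) = if toℕ a ≡ᵇ t + J then partialTerm (suc t) J v else []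
      entries : sumP entryTerm (allVecs (suc L) N) ≈ partialSum L (suc t) J
      entries =
        ≈-trans (sumP-allVecs-suc L N entryTerm)
          (≈-trans (sumP-cong (λ a → sumP-if (toℕ a ≡ᵇ t + J) (partialTerm (suc t) J) (allVecs L N)) (allFin N))
                   (sumP-at N (t + J) p<N (λ _ → partialSum L (suc t) J) (partialSum L (suc t) J) (λ _ _ → ≈-refl)))

  partialSum-zero : ∀ t J → J < M → partialSum 0 t J ≈ (qint (t ∸ J) ⊗ partialSum 0 t (suc J))
  partialSum-zero t J J<M rewrite +-∸-assoc 1 J<M | +-identityʳ t =
    ≈-trans (⊕-identityʳ _) (⊗-congʳ (qint (t ∸ J)) (≈-sym (⊕-identityʳ _)))

  partialSum≈walks : M + M ≤ N → ∀ k L t J → L + (M ∸ J) ≡ k → t + L ≡ M → J ≤ t → partialSum L t J ≈ walks k (t ∸ J)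
  partialSum≈walks M+M≤N zero zero t J e₁ e₂ J≤t rewrite +-identityʳ t | e₂ | e₁ = ≈-refl
  partialSum≈walks M+M≤N (suc k) (suc L) t J e₁ e₂ J≤t =
    ≈-trans (partialSum-suc L t J J<M p<N) (⊕-cong up down)
    where
      t<M : t < M
      t<M = subst (t <_) e₂ (m<m+n t (s≤s z≤n))
      J<M : J < M
      J<M = ≤-<-trans J≤t t<M
      p<N : t + J < N
      p<N = <-≤-trans (+-mono-<-≤ t<M (≤-trans J≤t (<⇒≤ t<M))) M+M≤N
      up : partialSum L (suc t) J ≈ walks k (suc (t ∸ J))
      up = ≈-trans (partialSum≈walks M+M≤N k L (suc t) J (suc-injective e₁) (trans (sym (+-suc t L)) e₂) (≤-trans J≤t (n≤1+n t)))
                   (≡⇒≈ (cong (walks k) (+-∸-assoc 1 J≤t)))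
      down : (qint (t ∸ J) ⊗ partialSum (suc L) t (suc J)) ≈ (qint (t ∸ J) ⊗ walks k ((t ∸ J) ∸ 1))
      down with m≤n⇒m<n∨m≡n J≤t
      ... | inj₂ refl rewrite n∸n≡0 J = ≈-refl
      ... | inj₁ J<t = ⊗-congʳ (qint (t ∸ J))
              (≈-trans (partialSum≈walks M+M≤N k (suc L) t (suc J)
                          (suc-injective (trans (sym (+-suc (suc L) (M ∸ suc J))) (trans (cong (suc L +_) (sym (+-∸-assoc 1 J<M))) e₁)))
                          e₂ J<t)
                       (≡⇒≈ (cong (walks k) (sym (trans (∸-+-assoc t J 1) (cong (t ∸_) (+-comm J 1)))))))
  partialSum≈walks M+M≤N (suc k) zero t J e₁ e₂ J≤t =
    ≈-trans (partialSum-zero t J J<M)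
      (⊕-cong {[]} {walks k (suc (t ∸ J))} (≈-sym (walks-unreachable k (suc (t ∸ J)) k<))
        (⊗-congʳ (qint (t ∸ J))
          (≈-trans (partialSum≈walks M+M≤N k zero t (suc J) (suc-injective (trans (sym (+-∸-assoc 1 J<M)) e₁)) e₂ J<t)
                   (≡⇒≈ (cong (walks k) (sym (trans (∸-+-assoc t J 1) (cong (t ∸_) (+-comm J 1)))))))))
    where
      t≡M : t ≡ M
      t≡M = trans (sym (+-identityʳ t)) e₂
      J<M : J < M
      J<M = m∸n≢0⇒n<m (λ e → 0≢1+n (trans (sym e) e₁))
      J<t : suc J ≤ t
      J<t = subst (J <_) (sym t≡M) J<M
      k< : k < suc (t ∸ J)
      k< = subst (λ z → k < suc z) (sym (trans (cong (_∸ J) t≡M) e₁)) (<-trans (n<1+n k) (n<1+n (suc k)))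

if-cong : ∀ {b b'} (x y : Poly) → b ≡ b' → x ≈ y → (if b then x else []) ≈ (if b' then y else [])
if-cong {true} x y refl e = e
if-cong {false} x y refl e = ≈-refl

RHS≈walks : ∀ m → RHS m ≈ walks (2 * m) 0
RHS≈walks m = begin
  RHS m
    ≈⟨ sumP-filter strictlyIncreasing? term (allVecs m (2 * m)) ⟩
  sumP (λ c → if does (strictlyIncreasing? c) then term c else []) (allVecs m (2 * m))
    ≈⟨ sumP-cong (λ c → if-cong (term c) (rProduct 0 0 m (values c)) (selected c) (term≈rProduct c)) (allVecs m (2 * m)) ⟩
  IncreasingSums.partialSum m (2 * m) m 0 0
    ≈⟨ IncreasingSums.partialSum≈walks m (2 * m) (≤-reflexive (cong (m +_) (sym (+-identityʳ m)))) (m + m) m 0 0 refl refl z≤n ⟩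
  walks (m + m) 0
    ≡⟨ cong (λ k → walks (m + k) 0) (sym (+-identityʳ m)) ⟩
  walks (2 * m) 0 ∎
  where
    open ≈-Reasoning
    selected : ∀ c → does (strictlyIncreasing? c) ≡ (increasing (values c) ∧ all (0 ≤ᵇ_) (values c))
    selected c = trans (does-strictlyIncreasing? c)
                   (sym (trans (cong (increasing (values c) ∧_) (all-0≤ᵇ (values c))) (∧-identityʳ (increasing (values c)))))

theorem5p3 : (m : ℕ) → T m ≈P RHS m
theorem5p3 m = ap (begin
  T m              ≈⟨ T≈walks m ⟩
  walks (2 * m) 0  ≈⟨ RHS≈walks m ⟨
  RHS m            ∎)
  where open ≈-Reasoning
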